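{- For $|q|<1$, $$\psi(q^3)\psi(q^5)=\varphi(q^{60})\psi(q^8)+q^{14}\varphi(q^4)\psi(q^{120})+q^3\psi(q^{12})\psi(q^{20})+q^5\varphi(q^{40})\psi(q^{48})+q^9\varphi(q^{24})\psi(q^{80}),$$ $$\psi(q)\psi(q^{15})=\varphi(q^{120})\psi(q^{16})+q^{28}\varphi(q^8)\psi(q^{240})+q^6\psi(q^4)\psi(q^{60})+q\varphi(q^{20})\psi(q^{24})+q^3\varphi(q^{12})\psi(q^{40}).$$
   Context: Ramanujan's theta functions are $\varphi(q)=\sum_{n=-\infty}^{\infty}q^{n^2}$ and $\psi(q)=\sum_{n=0}^{\infty}q^{n(n+1)/2}$ for $|q|<1$. -}

module Defs where

-- Formal power series in q with natural-number coefficients,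
-- represented by their coefficient sequences: (f n) = coefficient of q^n.

open import Data.Nat using (ℕ; _+_; _*_; _∸_; suc)
import Data.Nat as ℕ
open import Data.Integer as ℤ using (ℤ; +_)
open import Data.List using (List; upTo; map; filter; length)
open import Data.Nat.ListAction using (sum)

Series : Set
Series = ℕ → ℕ

-- phi(q) = sum_{m in Z} q^(m^2):
-- coefficient of q^n = number of integers m with m^2 = n
-- (all such m satisfy -n <= m <= n, so we count over that range).
φ : Series
φ n = length (filter (λ m → m ℤ.* m ℤ.≟ + n)
                     (map (λ i → + i ℤ.- + n) (upTo (suc (2 * n)))))

-- psi(q) = sum_{m >= 0} q^(m(m+1)/2):
-- coefficient of q^n = number of m >= 0 with m(m+1)/2 = n, i.e. m(m+1) = 2n
-- (all such m satisfy m <= n).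
ψ : Series
ψ n = length (filter (λ m → m * suc m ℕ.≟ 2 * n) (upTo (suc n)))

-- f(q^k): coefficient of q^n is the sum of f m over m with k*m = n.
dil : ℕ → Series → Series
dil k f n = sum (map f (filter (λ m → k * m ℕ.≟ n) (upTo (suc n))))

-- q^a * f(q): coefficient of q^n is f (n - a) if a <= n, else 0.
shift : ℕ → Series → Series
shift a f n = sum (map f (filter (λ m → a + m ℕ.≟ n) (upTo (suc n))))

_⊛_ : Series → Series → Series
(f ⊛ g) n = sum (map (λ i → f i * g (n ∸ i)) (upTo (suc n)))

infixl 7 _⊛_
infixl 6 _⊕_

_⊕_ : Series → Series → Series
(f ⊕ g) n = f n + g n

_≐_ : Series → Series → Set
f ≐ g = ∀ n → f n ≡ g n
  where open import Relation.Binary.PropositionalEquality using (_≡_)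

infix 4 _≐_

module Submission where

-- Two theta-function identities (ψ(q³)ψ(q⁵) and ψ(q)ψ(q¹⁵) as sums of five products),
-- proved coefficientwise by counting representations by binary quadratic forms.

open import Data.Nat using (ℕ)

module ListCounting where

  open import Data.Nat
  open import Data.Nat.Properties
  open import Data.List hiding (sum; product)
  open import Data.List.Properties using (length-map)
  open import Data.Nat.ListAction using (sum)
  open import Data.List.Membership.Propositional using (_∈_; _∉_)
  open import Data.List.Membership.Propositional.Properties
  open import Data.List.Relation.Unary.Any using (here; there)
  open import Data.List.Relation.Unary.Unique.Propositional using (Unique)
  import Data.List.Relation.Unary.Unique.Propositional.Properties as UP
  open import Data.List.Relation.Unary.AllPairs using ([]; _∷_)
  open import Data.List.Relation.Unary.All as All using (All; []; _∷_)
  import Data.List.Relation.Unary.All.Properties as AllP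
  open import Relation.Nullary
  open import Relation.Nullary.Decidable using (_×-dec_; ¬?)
  open import Relation.Unary using (Pred; Decidable)
  open import Relation.Binary.Definitions using (DecidableEquality)
  open import Relation.Binary.PropositionalEquality
  open import Data.Product using (_×_; _,_; ∃)
  open import Data.Empty using (⊥-elim)
  open import Function using (_∘_)
  open import Level using (0ℓ)
  open import Algebra.Properties.CommutativeSemigroup +-commutativeSemigroup using (interchange)

  module _ {A : Set} (_≟_ : DecidableEquality A) where
    remove : A → List A → List A
    remove x [] = []
    remove x (y ∷ ys) with x ≟ y
    ... | yes _ = ys
    ... | no _ = y ∷ remove x ys

    remove-length : ∀ {x ys} → x ∈ ys → suc (length (remove x ys)) ≡ length ys
    remove-length {x} {y ∷ ys} p with x ≟ y
    ... | yes _ = refl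
    ... | no x≢y with p
    ...   | here eq = ⊥-elim (x≢y eq)
    ...   | there q = cong suc (remove-length q)

    ∈-remove : ∀ {x z ys} → z ≢ x → z ∈ ys → z ∈ remove x ys
    ∈-remove {x} {z} {y ∷ ys} z≢x p with x ≟ y
    ∈-remove {x} {z} {y ∷ ys} z≢x (here eq) | yes refl = ⊥-elim (z≢x eq)
    ∈-remove {x} {z} {y ∷ ys} z≢x (there q) | yes refl = q
    ∈-remove {x} {z} {y ∷ ys} z≢x (here eq) | no _ = here eq
    ∈-remove {x} {z} {y ∷ ys} z≢x (there q) | no _ = there (∈-remove z≢x q)

    unique-length-≤ : ∀ {zs ws} → Unique zs → (∀ {z} → z ∈ zs → z ∈ ws) → length zs ≤ length ws
    unique-length-≤ {[]} _ _ = z≤n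
    unique-length-≤ {z ∷ zs} {ws} (z∉ ∷ u) sub =
      subst (suc (length zs) ≤_) (remove-length (sub (here refl)))
        (s≤s (unique-length-≤ u (λ q → ∈-remove (λ eq → All.lookup z∉ q (sym eq)) (sub (there q)))))

  map-unique : ∀ {A B : Set} (f : A → B) {xs : List A} →
    (∀ {x y} → x ∈ xs → y ∈ xs → f x ≡ f y → x ≡ y) → Unique xs → Unique (map f xs)
  map-unique f {[]} inj [] = []
  map-unique f {x ∷ xs} inj (h ∷ u) =
    AllP.map⁺ (All.tabulate (λ {y} q eq → All.lookup h q (inj (here refl) (there q) eq)))
    ∷ map-unique f (λ p q → inj (there p) (there q)) u

  filter-length-bijection : {A B : Set} → DecidableEquality B → {P : Pred A 0ℓ} {Q : Pred B 0ℓ}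
    (P? : Decidable P) (Q? : Decidable Q) (xs : List A) (ys : List B) →
    Unique xs → Unique ys → (f : A → B) →
    (∀ {x} → x ∈ xs → P x → f x ∈ ys × Q (f x)) →
    (∀ {x x'} → x ∈ xs → x' ∈ xs → P x → P x' → f x ≡ f x' → x ≡ x') →
    (∀ {y} → y ∈ ys → Q y → ∃ λ x → x ∈ xs × P x × f x ≡ y) →
    length (filter P? xs) ≡ length (filter Q? ys)
  filter-length-bijection _≟_ {P} {Q} P? Q? xs ys uxs uys f into inj onto = ≤-antisym le ge
    where
    le : length (filter P? xs) ≤ length (filter Q? ys)
    le = subst (_≤ length (filter Q? ys)) (length-map f (filter P? xs))
           (unique-length-≤ _≟_ (map-unique f (λ p q → let (p1 , p2) = ∈-filter⁻ P? p ; (q1 , q2) = ∈-filter⁻ P? q in inj p1 q1 p2 q2)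
                                (UP.filter⁺ P? uxs))
             (λ zm → let (x , xm , eq) = ∈-map⁻ f zm ; (x1 , x2) = ∈-filter⁻ P? xm ; (i1 , i2) = into x1 x2
                     in subst (_∈ filter Q? ys) (sym eq) (∈-filter⁺ Q? i1 i2)))
    ge : length (filter Q? ys) ≤ length (filter P? xs)
    ge = subst (length (filter Q? ys) ≤_) (length-map f (filter P? xs))
           (unique-length-≤ _≟_ (UP.filter⁺ Q? uys)
             (λ ym → let (y1 , y2) = ∈-filter⁻ Q? ym ; (x , x1 , x2 , eq) = onto y1 y2
                     in subst (_∈ map f (filter P? xs)) eq (∈-map⁺ f (∈-filter⁺ P? x1 x2))))

  filter-length-split : ∀ {A : Set} {P Q : Pred A 0ℓ} (P? : Decidable P) (Q? : Decidable Q) (xs : List A) →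
    length (filter P? xs) ≡ length (filter (λ x → P? x ×-dec Q? x) xs) + length (filter (λ x → P? x ×-dec ¬? (Q? x)) xs)
  filter-length-split P? Q? [] = refl
  filter-length-split P? Q? (x ∷ xs) with P? x | Q? x
  ... | yes _ | yes _ = cong suc (filter-length-split P? Q? xs)
  ... | yes _ | no _ = trans (cong suc (filter-length-split P? Q? xs)) (sym (+-suc _ _))
  ... | no _ | yes _ = filter-length-split P? Q? xs
  ... | no _ | no _ = filter-length-split P? Q? xs

  indicator : ∀ {P : Set} → Dec P → ℕ
  indicator (yes _) = 1
  indicator (no _) = 0

  length-filter-as-sum : ∀ {A : Set} {P : Pred A 0ℓ} (P? : Decidable P) (xs : List A) →
    length (filter P? xs) ≡ sum (map (λ x → indicator (P? x)) xs)
  length-filter-as-sum P? [] = refl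
  length-filter-as-sum P? (x ∷ xs) with P? x
  ... | yes _ = cong suc (length-filter-as-sum P? xs)
  ... | no _ = length-filter-as-sum P? xs

  sum-cong : ∀ {A : Set} {f g : A → ℕ} (xs : List A) → (∀ {x} → x ∈ xs → f x ≡ g x) → sum (map f xs) ≡ sum (map g xs)
  sum-cong [] h = refl
  sum-cong (x ∷ xs) h = cong₂ _+_ (h (here refl)) (sum-cong xs (h ∘ there))

  sum-scale : ∀ {A : Set} (c : ℕ) (f : A → ℕ) (xs : List A) → sum (map (λ x → c * f x) xs) ≡ c * sum (map f xs)
  sum-scale c f [] = sym (*-zeroʳ c)
  sum-scale c f (x ∷ xs) = trans (cong (c * f x +_) (sum-scale c f xs)) (sym (*-distribˡ-+ c (f x) _))

  sum-add : ∀ {A : Set} (f g : A → ℕ) (xs : List A) → sum (map (λ x → f x + g x) xs) ≡ sum (map f xs) + sum (map g xs)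
  sum-add f g [] = refl
  sum-add f g (x ∷ xs) =
    trans (cong (f x + g x +_) (sum-add f g xs)) (interchange (f x) (g x) (sum (map f xs)) (sum (map g xs)))

  sum-swap : ∀ {A B : Set} (h : A → B → ℕ) (xs : List A) (ys : List B) →
    sum (map (λ x → sum (map (λ y → h x y) ys)) xs) ≡ sum (map (λ y → sum (map (λ x → h x y) xs)) ys)
  sum-swap h [] ys = sym (sum-zero ys)
    where
    sum-zero : ∀ {B : Set} (ys : List B) → sum (map (λ _ → 0) ys) ≡ 0
    sum-zero [] = refl
    sum-zero (_ ∷ ys) = sum-zero ys
  sum-swap h (x ∷ xs) ys = trans (cong (sum (map (h x) ys) +_) (sum-swap h xs ys)) (sym (sum-add (h x) (λ y → sum (map (λ x → h x y) xs)) ys))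

  sum-product : ∀ {A B : Set} (f : A → ℕ) (g : B → ℕ) (xs : List A) (ys : List B) →
    sum (map f xs) * sum (map g ys) ≡ sum (map (λ x → sum (map (λ y → f x * g y) ys)) xs)
  sum-product f g [] ys = refl
  sum-product f g (x ∷ xs) ys = trans (*-distribʳ-+ (sum (map g ys)) (f x) _)
    (cong₂ _+_ (sym (sum-scale (f x) g ys)) (sum-product f g xs ys))

  sum-filter-as-indicator : ∀ {A : Set} {P : Pred A 0ℓ} (P? : Decidable P) (g : A → ℕ) (xs : List A) →
    sum (map g (filter P? xs)) ≡ sum (map (λ x → indicator (P? x) * g x) xs)
  sum-filter-as-indicator P? g [] = refl
  sum-filter-as-indicator P? g (x ∷ xs) with P? x
  ... | yes _ = cong₂ _+_ (sym (+-identityʳ (g x))) (sum-filter-as-indicator P? g xs)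
  ... | no _ = sum-filter-as-indicator P? g xs

  module _ {A : Set} (_≟_ : DecidableEquality A) where
    indicator-sum-absent : ∀ (c : A) (g : A → ℕ) (L : List A) → c ∉ L → sum (map (λ i → indicator (c ≟ i) * g i) L) ≡ 0
    indicator-sum-absent c g [] _ = refl
    indicator-sum-absent c g (i ∷ L) c∉ with c ≟ i
    ... | yes eq = ⊥-elim (c∉ (here eq))
    ... | no _ = indicator-sum-absent c g L (c∉ ∘ there)

    indicator-sum-present : ∀ (c : A) (g : A → ℕ) (L : List A) → Unique L → c ∈ L → sum (map (λ i → indicator (c ≟ i) * g i) L) ≡ g c
    indicator-sum-present c g (i ∷ L) (h ∷ u) p with c ≟ i
    ... | yes refl = trans (cong (g i + 0 +_) (indicator-sum-absent c g L (λ q → All.lookup h q refl))) (trans (+-identityʳ _) (+-identityʳ _))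
    ... | no c≢i with p
    ...   | here eq = ⊥-elim (c≢i eq)
    ...   | there q = indicator-sum-present c g L u q

  length-filter-cartesian : ∀ {A B : Set} {P : Pred (A × B) 0ℓ} (P? : Decidable P) (xs : List A) (ys : List B) →
    length (filter P? (cartesianProduct xs ys)) ≡ sum (map (λ x → length (filter (λ y → P? (x , y)) ys)) xs)
  length-filter-cartesian P? [] ys = refl
  length-filter-cartesian P? (x ∷ xs) ys = trans (lem ys (cartesianProduct xs ys)) (cong (_ +_) (length-filter-cartesian P? xs ys))
    where
    lem : ∀ zs ws → length (filter P? (map (x ,_) zs ++ ws)) ≡ length (filter (λ y → P? (x , y)) zs) + length (filter P? ws)
    lem [] ws = refl
    lem (z ∷ zs) ws with P? (x , z)
    ... | yes _ = cong suc (lem zs ws)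
    ... | no _ = lem zs ws

  filter-length-cong : ∀ {A : Set} {P Q : Pred A 0ℓ} (P? : Decidable P) (Q? : Decidable Q) (xs : List A) →
    (∀ x → P x → Q x) → (∀ x → Q x → P x) → length (filter P? xs) ≡ length (filter Q? xs)
  filter-length-cong P? Q? [] f g = refl
  filter-length-cong P? Q? (x ∷ xs) f g with P? x | Q? x
  ... | yes _ | yes _ = cong suc (filter-length-cong P? Q? xs f g)
  ... | yes p | no ¬q = ⊥-elim (¬q (f x p))
  ... | no ¬p | yes q = ⊥-elim (¬p (g x q))
  ... | no _ | no _ = filter-length-cong P? Q? xs f g

  indicator-cong : ∀ {P Q : Set} (p : Dec P) (q : Dec Q) → (P → Q) → (Q → P) → indicator p ≡ indicator q
  indicator-cong (yes _) (yes _) f g = refl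
  indicator-cong (yes p) (no ¬q) f g = ⊥-elim (¬q (f p))
  indicator-cong (no ¬p) (yes q) f g = ⊥-elim (¬p (g q))
  indicator-cong (no _) (no _) f g = refl

  indicator-false : ∀ {P : Set} (p : Dec P) → ¬ P → indicator p ≡ 0
  indicator-false (yes p) ¬p = ⊥-elim (¬p p)
  indicator-false (no _) _ = refl

module LatticeCounts where

  -- Both theta functions are generating functions of a weight on ℤ:
  -- φ(q) = Σ q^(x²) and 2ψ(q) = Σ_{x ∈ ℤ} q^(x(x+1)/2) (x and -1-x give the same
  -- triangular number).  Dilations, shifts and products of such series are then
  -- generating functions of weights on ℤ², and every coefficient in the identities
  -- becomes a count of lattice points in a large enough box.

  open import Defs
  open ListCounting
  open import Data.Nat as ℕ using (ℕ; zero; suc; _≤_; _<_; z≤n; s≤s; _∸_)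
  import Data.Nat.Properties as NP
  open import Data.Nat.Tactic.RingSolver using (solve-∀)
  open import Data.Integer as ℤ using (ℤ; +_; -[1+_]; ∣_∣)
  import Data.Integer.Properties as ZP
  import Data.Integer.Tactic.RingSolver as ZR
  open import Data.List hiding (sum; product)
  open import Data.Nat.ListAction using (sum)
  open import Data.List.Membership.Propositional using (_∈_)
  open import Data.List.Membership.Propositional.Properties
  open import Data.List.Relation.Unary.Any using (here; there)
  open import Data.List.Relation.Unary.Unique.Propositional using (Unique)
  import Data.List.Relation.Unary.Unique.Propositional.Properties as UP
  open import Data.List.Relation.Unary.AllPairs using ([]; _∷_)
  open import Data.List.Relation.Unary.All as All using ([]; _∷_)
  open import Relation.Nullary
  open import Relation.Nullary.Decidable using (_×-dec_; ¬?)
  open import Relation.Unary using (Decidable)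
  open import Relation.Binary.Definitions using (DecidableEquality)
  open import Relation.Binary.PropositionalEquality
  open import Data.Product using (_×_; _,_; ∃; proj₁; proj₂)
  open import Data.Product.Properties using (≡-dec)
  open import Data.Sum using (inj₁; inj₂)
  open import Data.Empty using (⊥; ⊥-elim)
  open import Data.Unit using (⊤; tt)

  triangle : ℕ → ℕ
  triangle zero = 0
  triangle (suc m) = suc m ℕ.+ triangle m

  twice-triangle : ∀ m → 2 ℕ.* triangle m ≡ m ℕ.* suc m
  twice-triangle zero = refl
  twice-triangle (suc m) = begin
      2 ℕ.* (suc m ℕ.+ triangle m)      ≡⟨ NP.*-distribˡ-+ 2 (suc m) (triangle m) ⟩
      2 ℕ.* suc m ℕ.+ 2 ℕ.* triangle m  ≡⟨ cong (2 ℕ.* suc m ℕ.+_) (twice-triangle m) ⟩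
      2 ℕ.* suc m ℕ.+ m ℕ.* suc m       ≡⟨ NP.*-distribʳ-+ (suc m) 2 m ⟨
      suc (suc m) ℕ.* suc m             ≡⟨ NP.*-comm (suc (suc m)) (suc m) ⟩
      suc m ℕ.* suc (suc m)             ∎
    where open ≡-Reasoning

  ≤-triangle : ∀ m → m ≤ triangle m
  ≤-triangle zero = z≤n
  ≤-triangle (suc m) = NP.m≤m+n (suc m) (triangle m)

  triangular : ℤ → ℕ
  triangular (+ m) = triangle m
  triangular -[1+ m ] = triangle m

  square : ℤ → ℕ
  square x = ∣ x ∣ ℕ.* ∣ x ∣

  square-ℤ : ∀ x → x ℤ.* x ≡ + square x
  square-ℤ (+ n) = sym (ZP.pos-* n n)
  square-ℤ -[1+ n ] = refl

  ≤-square : ∀ a → a ≤ a ℕ.* a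
  ≤-square zero = z≤n
  ≤-square (suc a) = NP.m≤m*n (suc a) (suc a)

  range : ℕ → List ℤ
  range zero = + 0 ∷ []
  range (suc R) = + suc R ∷ -[1+ R ] ∷ range R

  range-bound : ∀ {R x} → x ∈ range R → ∣ x ∣ ≤ R
  range-bound {zero} (here refl) = z≤n
  range-bound {suc R} (here refl) = NP.≤-refl
  range-bound {suc R} (there (here refl)) = NP.≤-refl
  range-bound {suc R} (there (there p)) = NP.m≤n⇒m≤1+n (range-bound p)

  ∈-range : ∀ R x → ∣ x ∣ ≤ R → x ∈ range R
  ∈-range zero (+ zero) _ = here refl
  ∈-range (suc R) (+ n) le with NP.m≤n⇒m<n∨m≡n le
  ... | inj₁ (s≤s lt) = there (there (∈-range R (+ n) lt))
  ... | inj₂ refl = here refl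
  ∈-range (suc R) -[1+ n ] (s≤s le) with NP.m≤n⇒m<n∨m≡n le
  ... | inj₁ lt = there (there (∈-range R -[1+ n ] lt))
  ... | inj₂ refl = there (here refl)

  range-unique : ∀ R → Unique (range R)
  range-unique zero = [] ∷ []
  range-unique (suc R) = ((λ ()) ∷ All.tabulate (λ p eq → NP.<-irrefl refl (subst (λ y → ∣ y ∣ ≤ R) (sym eq) (range-bound p))))
                   ∷ All.tabulate (λ p eq → NP.<-irrefl refl (subst (λ y → ∣ y ∣ ≤ R) (sym eq) (range-bound p)))
                   ∷ range-unique R

  box : ℕ → List (ℤ × ℤ)
  box R = cartesianProduct (range R) (range R)

  box-unique : ∀ R → Unique (box R)
  box-unique R = UP.cartesianProduct⁺ (range-unique R) (range-unique R)

  ∈-box : ∀ {R x y} → ∣ x ∣ ≤ R → ∣ y ∣ ≤ R → (x , y) ∈ box R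
  ∈-box {R} {x} {y} p q = ∈-cartesianProduct⁺ (∈-range R x p) (∈-range R y q)

  _≟ℤ²_ : DecidableEquality (ℤ × ℤ)
  _≟ℤ²_ = ≡-dec ℤ._≟_ ℤ._≟_

  -- "e·f is the generating function of the weight H on the window [-R,R]":
  -- below R, e times the n-th coefficient of f counts the x ∈ [-R,R] with H x = n.
  Models : ℕ → Series → (ℤ → ℕ) → ℕ → Set
  Models e f H R = ∀ i → i < R → e ℕ.* f i ≡ length (filter (λ x → H x ℕ.≟ i) (range R))

  -- φ is the generating function of the square weight (multiplicity 1): the definition of φ
  -- enumerates the candidates j - i (j ≤ 2i), and those with square i are exactly the
  -- x ∈ [-R, R] with x² = i.
  φ-models : ∀ R → Models 1 φ square R
  φ-models R i i<R =
    trans (NP.*-identityˡ (φ i))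
     (filter-length-bijection ℤ._≟_ (λ m → m ℤ.* m ℤ.≟ + i) (λ x → square x ℕ.≟ i) L (range R) L-unique (range-unique R) (λ x → x) into (λ _ _ _ _ e → e) onto)
    where
    recentre : ℕ → ℤ
    recentre j = + j ℤ.- + i
    L : List ℤ
    L = map recentre (upTo (suc (2 ℕ.* i)))
    recentre-inverse : ∀ j → + j ≡ recentre j ℤ.+ + i
    recentre-inverse j = cancel (+ j) (+ i)
      where
      cancel : ∀ a b → a ≡ (a ℤ.- b) ℤ.+ b
      cancel = ZR.solve-∀
    L-unique : Unique L
    L-unique = map-unique recentre (λ {j} {j'} _ _ eq → ZP.+-injective (trans (recentre-inverse j) (trans (cong (ℤ._+ + i) eq) (sym (recentre-inverse j'))))) (UP.upTo⁺ _)
    into : ∀ {m} → m ∈ L → m ℤ.* m ≡ + i → m ∈ range R × square m ≡ i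
    into {m} _ eq = let s = ZP.+-injective (trans (sym (square-ℤ m)) eq) in
      ∈-range R m (NP.≤-trans (subst (∣ m ∣ ≤_) s (≤-square ∣ m ∣)) (NP.<⇒≤ i<R)) , s
    onto : ∀ {y} → y ∈ range R → square y ≡ i → ∃ λ x → x ∈ L × x ℤ.* x ≡ + i × x ≡ y
    onto {+ m} _ s = + m , subst (_∈ L) hits (∈-map⁺ recentre (∈-upTo⁺ (s≤s index-bound))) , trans (square-ℤ (+ m)) (cong +_ s) , refl
      where
      m≤i : m ≤ i
      m≤i = subst (m ≤_) s (≤-square m)
      index-bound : m ℕ.+ i ≤ 2 ℕ.* i
      index-bound = subst (m ℕ.+ i ≤_) (cong (i ℕ.+_) (sym (NP.+-identityʳ i))) (NP.+-monoˡ-≤ i m≤i)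
      hits : recentre (m ℕ.+ i) ≡ + m
      hits = cancel (+ m) (+ i)
        where
        cancel : ∀ a b → (a ℤ.+ b) ℤ.- b ≡ a
        cancel = ZR.solve-∀
    onto { -[1+ m ]} _ s = -[1+ m ] , subst (_∈ L) hits (∈-map⁺ recentre (∈-upTo⁺ (s≤s index-bound))) , trans (square-ℤ -[1+ m ]) (cong +_ s) , refl
      where
      sm≤i : suc m ≤ i
      sm≤i = subst (suc m ≤_) s (≤-square (suc m))
      j : ℕ
      j = i ∸ suc m
      index-bound : j ≤ 2 ℕ.* i
      index-bound = NP.≤-trans (NP.m∸n≤m i (suc m)) (NP.m≤m+n i _)
      hits : recentre j ≡ -[1+ m ]
      hits = trans (cong (λ t → + j ℤ.- t) (cong +_ (sym (NP.m∸n+n≡m sm≤i)))) (cancel (+ j) (+ suc m))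
        where
        cancel : ∀ a b → a ℤ.- (a ℤ.+ b) ≡ ℤ.- b
        cancel = ZR.solve-∀

  -- Nonnegative integers; they enumerate one of the two halves of ℤ
  -- that each parametrise the exponents of ψ once.
  NonNeg : ℤ → Set
  NonNeg (+ _) = ⊤
  NonNeg -[1+ _ ] = ⊥

  NonNeg? : Decidable NonNeg
  NonNeg? (+ _) = yes tt
  NonNeg? -[1+ _ ] = no (λ ())

  ψ-half-count : ∀ R i → i < R → (Q : ℤ → Set) (Q? : Decidable Q) (c : ℕ → ℤ) →
    (∀ m → Q (c m)) → (∀ {m m'} → c m ≡ c m' → m ≡ m') → (∀ m → ∣ c m ∣ ≤ suc m) →
    (∀ y → Q y → ∃ λ m → c m ≡ y) → (∀ m → triangular (c m) ≡ triangle m) →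
    ψ i ≡ length (filter (λ x → (triangular x ℕ.≟ i) ×-dec Q? x) (range R))
  ψ-half-count R i i<R Q Q? c cQ cinj cbnd conto tri-c =
    filter-length-bijection ℤ._≟_ (λ m → m ℕ.* suc m ℕ.≟ 2 ℕ.* i) (λ x → (triangular x ℕ.≟ i) ×-dec Q? x)
      (upTo (suc i)) (range R) (UP.upTo⁺ (suc i)) (range-unique R) c into (λ _ _ _ _ → cinj) onto
    where
    into : ∀ {m} → m ∈ upTo (suc i) → m ℕ.* suc m ≡ 2 ℕ.* i → c m ∈ range R × (triangular (c m) ≡ i × Q (c m))
    into {m} p eq = ∈-range R (c m) (NP.≤-trans (cbnd m) (NP.≤-trans (s≤s (NP.<⇒≤pred (∈-upTo⁻ p))) i<R)) ,
                    (trans (tri-c m) (NP.*-cancelˡ-≡ (triangle m) i 2 (trans (twice-triangle m) eq)) , cQ m)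
    onto : ∀ {y} → y ∈ range R → (triangular y ≡ i × Q y) → ∃ λ m → m ∈ upTo (suc i) × m ℕ.* suc m ≡ 2 ℕ.* i × c m ≡ y
    onto {y} p (ti , qy) with conto y qy
    ... | m , refl = m , ∈-upTo⁺ (s≤s (subst (m ≤_) (trans (sym (tri-c m)) ti) (≤-triangle m))) ,
                     trans (sym (twice-triangle m)) (cong (2 ℕ.*_) (trans (sym (tri-c m)) ti)) , refl

  -- 2ψ is the generating function of the triangular weight: x ≥ 0 and x < 0 each contribute ψ.
  ψ-models : ∀ R → Models 2 ψ triangular R
  ψ-models R i i<R =
    trans (cong (ψ i ℕ.+_) (NP.+-identityʳ (ψ i)))
     (trans (cong₂ ℕ._+_
       (ψ-half-count R i i<R NonNeg NonNeg? +_ (λ _ → tt) (λ { refl → refl }) (λ m → NP.n≤1+n m)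
          (λ { (+ m) _ → m , refl ; -[1+ m ] () }) (λ _ → refl))
       (ψ-half-count R i i<R (λ x → ¬ NonNeg x) (λ x → ¬? (NonNeg? x)) -[1+_] (λ _ ()) (λ { refl → refl }) (λ m → NP.≤-refl)
          (λ { (+ m) h → ⊥-elim (h tt) ; -[1+ m ] _ → m , refl }) (λ _ → refl)))
       (sym (filter-length-split (λ x → triangular x ℕ.≟ i) NonNeg? (range R))))

  reindex-count : ∀ {A : Set} (xs : List A) (S : A → ℕ) (f : ℕ → ℕ) (e : ℕ) (φ' : ℕ → ℕ) (n : ℕ) →
    (∀ m → φ' m ≡ n → m ≤ n) →
    (∀ m → m ≤ n → e ℕ.* f m ≡ length (filter (λ p → S p ℕ.≟ m) xs)) →
    e ℕ.* sum (map f (filter (λ m → φ' m ℕ.≟ n) (upTo (suc n)))) ≡ length (filter (λ p → φ' (S p) ℕ.≟ n) xs)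
  reindex-count xs S f e φ' n bnd fac =
    begin
      e ℕ.* sum (map f (filter (λ m → φ' m ℕ.≟ n) U))
    ≡⟨ sym (sum-scale e f (filter (λ m → φ' m ℕ.≟ n) U)) ⟩
      sum (map (λ m → e ℕ.* f m) (filter (λ m → φ' m ℕ.≟ n) U))
    ≡⟨ sum-filter-as-indicator (λ m → φ' m ℕ.≟ n) (λ m → e ℕ.* f m) U ⟩
      sum (map (λ m → indicator (φ' m ℕ.≟ n) ℕ.* (e ℕ.* f m)) U)
    ≡⟨ sum-cong U (λ {m} p → cong (indicator (φ' m ℕ.≟ n) ℕ.*_) (trans (fac m (NP.<⇒≤pred (∈-upTo⁻ p))) (length-filter-as-sum (λ q → S q ℕ.≟ m) xs))) ⟩
      sum (map (λ m → indicator (φ' m ℕ.≟ n) ℕ.* sum (map (λ q → indicator (S q ℕ.≟ m)) xs)) U)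
    ≡⟨ sum-cong U (λ {m} _ → sym (sum-scale (indicator (φ' m ℕ.≟ n)) (λ q → indicator (S q ℕ.≟ m)) xs)) ⟩
      sum (map (λ m → sum (map (λ q → indicator (φ' m ℕ.≟ n) ℕ.* indicator (S q ℕ.≟ m)) xs)) U)
    ≡⟨ sum-swap (λ m q → indicator (φ' m ℕ.≟ n) ℕ.* indicator (S q ℕ.≟ m)) U xs ⟩
      sum (map (λ q → sum (map (λ m → indicator (φ' m ℕ.≟ n) ℕ.* indicator (S q ℕ.≟ m)) U)) xs)
    ≡⟨ sum-cong xs (λ {q} _ → delta-collapse (S q)) ⟩
      sum (map (λ q → indicator (φ' (S q) ℕ.≟ n)) xs)
    ≡⟨ sym (length-filter-as-sum (λ q → φ' (S q) ℕ.≟ n) xs) ⟩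
      length (filter (λ p → φ' (S p) ℕ.≟ n) xs)
    ∎
    where
    open ≡-Reasoning
    U : List ℕ
    U = upTo (suc n)
    delta-collapse : ∀ c → sum (map (λ m → indicator (φ' m ℕ.≟ n) ℕ.* indicator (c ℕ.≟ m)) U) ≡ indicator (φ' c ℕ.≟ n)
    delta-collapse c = trans (sum-cong U (λ {m} _ → NP.*-comm (indicator (φ' m ℕ.≟ n)) (indicator (c ℕ.≟ m)))) (h (c ℕ.<? suc n))
      where
      h : Dec (c < suc n) → sum (map (λ m → indicator (c ℕ.≟ m) ℕ.* indicator (φ' m ℕ.≟ n)) U) ≡ indicator (φ' c ℕ.≟ n)
      h (yes c<) = indicator-sum-present ℕ._≟_ c (λ m → indicator (φ' m ℕ.≟ n)) U (UP.upTo⁺ (suc n)) (∈-upTo⁺ c<)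
      h (no c≮) = trans (indicator-sum-absent ℕ._≟_ c (λ m → indicator (φ' m ℕ.≟ n)) U (λ q → c≮ (∈-upTo⁻ q)))
                        (sym (indicator-false (φ' c ℕ.≟ n) (λ eq → c≮ (s≤s (bnd c eq)))))

  dil-models : ∀ e f H R k → .{{_ : ℕ.NonZero k}} → Models e f H R → Models e (dil k f) (λ x → k ℕ.* H x) R
  dil-models e f H R k fac i i<R =
    reindex-count (range R) H f e (k ℕ.*_) i (λ m eq → subst (m ≤_) eq (NP.m≤n*m m k))
          (λ m m≤i → fac m (NP.≤-<-trans m≤i i<R))

  shift-count : ∀ {A : Set} (xs : List A) (S : A → ℕ) (f : Series) (e a n : ℕ) →
    (∀ m → m ≤ n → e ℕ.* f m ≡ length (filter (λ p → S p ℕ.≟ m) xs)) →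
    e ℕ.* shift a f n ≡ length (filter (λ p → a ℕ.+ S p ℕ.≟ n) xs)
  shift-count xs S f e a n fac = reindex-count xs S f e (a ℕ.+_) n (λ m eq → subst (m ≤_) eq (NP.m≤n+m m a)) fac

  convolution-indicator : ∀ c d n → sum (map (λ i → indicator (c ℕ.≟ i) ℕ.* indicator (d ℕ.≟ n ∸ i)) (upTo (suc n))) ≡ indicator (c ℕ.+ d ℕ.≟ n)
  convolution-indicator c d n with c ℕ.<? suc n
  ... | yes (s≤s c≤n) = trans (indicator-sum-present ℕ._≟_ c (λ i → indicator (d ℕ.≟ n ∸ i)) (upTo (suc n)) (UP.upTo⁺ (suc n)) (∈-upTo⁺ (s≤s c≤n)))
          (indicator-cong (d ℕ.≟ n ∸ c) (c ℕ.+ d ℕ.≟ n) (λ eq → trans (cong (c ℕ.+_) eq) (NP.m+[n∸m]≡n c≤n))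
                   (λ eq → trans (sym (NP.m+n∸m≡n c d)) (cong (_∸ c) eq)))
  ... | no c≮ = trans (indicator-sum-absent ℕ._≟_ c (λ i → indicator (d ℕ.≟ n ∸ i)) (upTo (suc n)) (λ q → c≮ (∈-upTo⁻ q)))
          (sym (indicator-false (c ℕ.+ d ℕ.≟ n) (λ eq → c≮ (s≤s (subst (c ≤_) eq (NP.m≤m+n c d))))))

  product-count : ∀ e₁ e₂ f g H G R n → Models e₁ f H R → Models e₂ g G R → n < R →
    e₁ ℕ.* e₂ ℕ.* (f ⊛ g) n ≡ length (filter (λ p → H (proj₁ p) ℕ.+ G (proj₂ p) ℕ.≟ n) (box R))
  product-count e₁ e₂ f g H G R n facf facg n<R =
    begin
      e₁ ℕ.* e₂ ℕ.* sum (map (λ i → f i ℕ.* g (n ∸ i)) U)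
    ≡⟨ sym (sum-scale (e₁ ℕ.* e₂) (λ i → f i ℕ.* g (n ∸ i)) U) ⟩
      sum (map (λ i → e₁ ℕ.* e₂ ℕ.* (f i ℕ.* g (n ∸ i))) U)
    ≡⟨ sum-cong U (λ {i} p → trans (ar e₁ e₂ (f i) (g (n ∸ i)))
          (cong₂ ℕ._*_ (trans (facf i (NP.≤-<-trans (NP.<⇒≤pred (∈-upTo⁻ p)) n<R)) (length-filter-as-sum (λ x → H x ℕ.≟ i) (range R)))
                       (trans (facg (n ∸ i) (NP.≤-<-trans (NP.m∸n≤m n i) n<R)) (length-filter-as-sum (λ y → G y ℕ.≟ n ∸ i) (range R))))) ⟩
      sum (map (λ i → sum (map (λ x → indicator (H x ℕ.≟ i)) X) ℕ.* sum (map (λ y → indicator (G y ℕ.≟ n ∸ i)) X)) U)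
    ≡⟨ sum-cong U (λ {i} _ → sum-product (λ x → indicator (H x ℕ.≟ i)) (λ y → indicator (G y ℕ.≟ n ∸ i)) X X) ⟩
      sum (map (λ i → sum (map (λ x → sum (map (λ y → indicator (H x ℕ.≟ i) ℕ.* indicator (G y ℕ.≟ n ∸ i)) X)) X)) U)
    ≡⟨ sum-swap (λ i x → sum (map (λ y → indicator (H x ℕ.≟ i) ℕ.* indicator (G y ℕ.≟ n ∸ i)) X)) U X ⟩
      sum (map (λ x → sum (map (λ i → sum (map (λ y → indicator (H x ℕ.≟ i) ℕ.* indicator (G y ℕ.≟ n ∸ i)) X)) U)) X)
    ≡⟨ sum-cong X (λ {x} _ → sum-swap (λ i y → indicator (H x ℕ.≟ i) ℕ.* indicator (G y ℕ.≟ n ∸ i)) U X) ⟩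
      sum (map (λ x → sum (map (λ y → sum (map (λ i → indicator (H x ℕ.≟ i) ℕ.* indicator (G y ℕ.≟ n ∸ i)) U)) X)) X)
    ≡⟨ sum-cong X (λ {x} _ → sum-cong X (λ {y} _ → convolution-indicator (H x) (G y) n)) ⟩
      sum (map (λ x → sum (map (λ y → indicator (H x ℕ.+ G y ℕ.≟ n)) X)) X)
    ≡⟨ sum-cong X (λ {x} _ → sym (length-filter-as-sum (λ y → H x ℕ.+ G y ℕ.≟ n) X)) ⟩
      sum (map (λ x → length (filter (λ y → H x ℕ.+ G y ℕ.≟ n) X)) X)
    ≡⟨ sym (length-filter-cartesian (λ p → H (proj₁ p) ℕ.+ G (proj₂ p) ℕ.≟ n) X X) ⟩
      length (filter (λ p → H (proj₁ p) ℕ.+ G (proj₂ p) ℕ.≟ n) (box R))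
    ∎
    where
    open ≡-Reasoning
    U : List ℕ
    U = upTo (suc n)
    X : List ℤ
    X = range R
    ar : ∀ a b c d → a ℕ.* b ℕ.* (c ℕ.* d) ≡ (a ℕ.* c) ℕ.* (b ℕ.* d)
    ar = solve-∀

  shifted-product-count : ∀ e₁ e₂ f g H G R a n → Models e₁ f H R → Models e₂ g G R → n < R →
    e₁ ℕ.* e₂ ℕ.* shift a (f ⊛ g) n ≡ length (filter (λ p → a ℕ.+ (H (proj₁ p) ℕ.+ G (proj₂ p)) ℕ.≟ n) (box R))
  shifted-product-count e₁ e₂ f g H G R a n f-models g-models n<R =
    shift-count (box R) (λ p → H (proj₁ p) ℕ.+ G (proj₂ p)) (f ⊛ g) (e₁ ℕ.* e₂) a n
      (λ m m≤n → product-count e₁ e₂ f g H G R m f-models g-models (NP.≤-<-trans m≤n n<R))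

module OddIntegers where

  -- Arithmetic of odd integers modulo 8.  The key fact is residue-cover:
  -- for odd X, Y the quotient X/Y is ≡ ±1 or ±3 (mod 8), i.e. exactly one of
  -- X ∓ Y, X ∓ 3Y is divisible by 8 (the odd residues mod 8 form the group {±1, ±3}).

  open import Data.Nat as ℕ using (ℕ; suc; s≤s)
  import Data.Nat.Properties as NP
  open import Data.Integer as ℤ using (ℤ; +_; ∣_∣; _+_; _*_; _-_; -_)
  import Data.Integer.Properties as ZP
  import Data.Integer.DivMod as ZD
  open import Data.Integer.Divisibility.Signed using (_∣_; divides; _∣?_; ∣-trans)
  open import Data.Integer.Tactic.RingSolver using (solve-∀)
  open import Relation.Nullary
  open import Relation.Unary using (Decidable)
  open import Relation.Binary.PropositionalEquality
  open import Data.Product using (_,_; ∃)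
  open import Data.Sum using (_⊎_; inj₁; inj₂)
  open import Data.Empty using (⊥; ⊥-elim)

  odd : ℤ → ℤ
  odd z = + 2 * z + + 1

  Odd : ℤ → Set
  Odd u = + 2 ∣ (u - + 1)

  Odd? : Decidable Odd
  Odd? u = + 2 ∣? (u - + 1)

  Div : ℕ → ℤ → Set
  Div d u = + d ∣ u

  Div? : ∀ d → Decidable (Div d)
  Div? d u = + d ∣? u

  Odd-odd : ∀ a → Odd (odd a)
  Odd-odd a = divides a (lem a)
    where
    lem : ∀ a → (+ 2 * a + + 1) - + 1 ≡ a * + 2
    lem = solve-∀

  Odd⇒odd : ∀ {X} → Odd X → ∃ λ a → X ≡ odd a
  Odd⇒odd {X} (divides q eq) = q , trans (l1 X) (trans (cong (_+ + 1) eq) (l2 q))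
    where
    l1 : ∀ X → X ≡ (X - + 1) + + 1
    l1 = solve-∀
    l2 : ∀ q → q * + 2 + + 1 ≡ + 2 * q + + 1
    l2 = solve-∀

  parity : ∀ w → (∃ λ j → w ≡ + 2 * j) ⊎ (∃ λ j → w ≡ odd j)
  parity w with w ZD.% + 2 | ZD.n%d<d w (+ 2) | ZD.a≡a%n+[a/n]*n w (+ 2)
  ... | 0 | _ | eq = inj₁ (w ZD./ + 2 , trans eq (l (w ZD./ + 2)))
    where
    l : ∀ q → + 0 + q * + 2 ≡ + 2 * q
    l = solve-∀
  ... | 1 | _ | eq = inj₂ (w ZD./ + 2 , trans eq (l (w ZD./ + 2)))
    where
    l : ∀ q → + 1 + q * + 2 ≡ + 2 * q + + 1
    l = solve-∀
  ... | suc (suc _) | s≤s (s≤s ()) | _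

  even≢odd : ∀ q t → + 2 * q ≢ odd t
  even≢odd q t eq = contradiction (NP.m*n≡1⇒m≡1 2 ∣ q - t ∣ twice-∣q-t∣≡1) (λ ())
    where
    expand : ∀ q t → + 2 * (q - t) ≡ + 2 * q - + 2 * t
    expand = solve-∀
    cancel : ∀ t → (+ 2 * t + + 1) - + 2 * t ≡ + 1
    cancel = solve-∀
    twice-∣q-t∣≡1 : 2 ℕ.* ∣ q - t ∣ ≡ 1
    twice-∣q-t∣≡1 = trans (sym (ZP.abs-* (+ 2) (q - t)))
                      (cong ∣_∣ (trans (expand q t) (trans (cong (_- + 2 * t) eq) (cancel t))))

  odd-not-even : ∀ t {E} → E ≡ odd t → ¬ Div 2 E
  odd-not-even t {E} eq (divides q eq2) = even≢odd q t (trans (ZP.*-comm (+ 2) q) (trans (sym eq2) eq))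

  not-even-odd : ∀ w → ¬ Div 2 w → ∃ λ j → w ≡ odd j
  not-even-odd w ¬2∣w with parity w
  ... | inj₁ (j , w≡2j) = ⊥-elim (¬2∣w (divides j (trans w≡2j (ZP.*-comm (+ 2) j))))
  ... | inj₂ odd-w = odd-w

  not-double-divides : ∀ (e : ℕ) {{_ : ℕ.NonZero e}} (t E : ℤ) → E ≡ + e * odd t → ¬ (+ (2 ℕ.* e) ∣ E)
  not-double-divides e t E eq (divides q eq2) = even≢odd q t (ZP.*-cancelˡ-≡ (+ e) (+ 2 * q) (odd t) (trans (sym h) eq))
    where
    h : E ≡ + e * (+ 2 * q)
    h = trans eq2 (trans (cong (q *_) (ZP.pos-* 2 e)) (l q (+ 2) (+ e)))
      where
      l : ∀ q a b → q * (a * b) ≡ b * (a * q)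
      l = solve-∀

  not-multiple-double-divides : ∀ (k e : ℕ) {{_ : ℕ.NonZero e}} (t E : ℤ) → E ≡ + e * odd t → ¬ (+ (k ℕ.* (2 ℕ.* e)) ∣ E)
  not-multiple-double-divides k e t E eq d = not-double-divides e t E eq (∣-trans (divides (+ k) (ZP.pos-* k (2 ℕ.* e))) d)

  even-quotient : ∀ d j {E} → E ≡ (+ 2 * j) * + d → Div (2 ℕ.* d) E
  even-quotient d j eq = divides j (trans eq (trans (regroup j (+ d)) (cong (j *_) (sym (ZP.pos-* 2 d)))))
    where
    regroup : ∀ j d → (+ 2 * j) * d ≡ j * (+ 2 * d)
    regroup = solve-∀

  Odd-neg : ∀ {Y} → Odd Y → Odd (- Y)
  Odd-neg {Y} ow with Odd⇒odd {Y} ow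
  ... | b , refl = subst Odd (l b) (Odd-odd (- b - + 1))
    where
    l : ∀ b → + 2 * (- b - + 1) + + 1 ≡ - (+ 2 * b + + 1)
    l = solve-∀

  Odd-triple : ∀ {Y} → Odd Y → Odd (+ 3 * Y)
  Odd-triple {Y} ow with Odd⇒odd {Y} ow
  ... | b , refl = subst Odd (l b) (Odd-odd (+ 3 * b + + 1))
    where
    l : ∀ b → + 2 * (+ 3 * b + + 1) + + 1 ≡ + 3 * (+ 2 * b + + 1)
    l = solve-∀

  -- X - W and X + W cannot both be divisible by 8 when W is odd (their difference is 2W).
  not-both-±mod8 : ∀ X W → Odd W → Div 8 (X - W) → Div 8 (X + W) → ⊥
  not-both-±mod8 X W ow (divides q1 e1) (divides q2 e2) with Odd⇒odd {W} ow
  ... | b , refl = even≢odd (+ 2 * (q2 - q1)) b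
        (ZP.*-cancelˡ-≡ (+ 2) _ _ (trans (l q1 q2) (trans (cong₂ _-_ (sym e2) (sym e1)) (l2 X b))))
    where
    l : ∀ q1 q2 → + 2 * (+ 2 * (+ 2 * (q2 - q1))) ≡ q2 * + 8 - q1 * + 8
    l = solve-∀
    l2 : ∀ X b → (X + (+ 2 * b + + 1)) - (X - (+ 2 * b + + 1)) ≡ + 2 * (+ 2 * b + + 1)
    l2 = solve-∀

  -- For odd X, Y one of X - Y, X + Y, X - 3Y, X + 3Y is divisible by 8.
  -- Write X = 2a+1, Y = 2b+1.  If a - b = 4i then 8 ∣ X - Y; if a - b = 4i + 2 then
  -- 8 ∣ X + 3Y; if a - b = 2j + 1 then X + Y = 4(j+b+1) and X - 3Y = 4(j-b), and one
  -- of the two factors j+b+1, j-b is even.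
  residue-cover : ∀ {X Y} → Odd X → Odd Y → ¬ Div 8 (X - Y) → ¬ Div 8 (X + Y) → ¬ Div 8 (X - + 3 * Y) → Div 8 (X + + 3 * Y)
  residue-cover {X} {Y} ox oy n1 n2 n3 with Odd⇒odd {X} ox | Odd⇒odd {Y} oy
  ... | a , refl | b , refl with parity (a - b)
  ... | inj₁ (j , ej) = case1 (parity j)
    where
    ea : a ≡ b + + 2 * j
    ea = trans (la a b) (cong (λ s → b + s) ej)
      where
      la : ∀ a b → a ≡ b + (a - b)
      la = solve-∀
    case1 : (∃ λ i → j ≡ + 2 * i) ⊎ (∃ λ i → j ≡ odd i) → Div 8 (odd a + + 3 * odd b)
    case1 (inj₁ (i , ei)) = ⊥-elim (n1 (divides i (trans (cong (λ t → odd t - odd b) (trans ea (cong (λ s → b + + 2 * s) ei))) (l b i))))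
      where
      l : ∀ b i → (+ 2 * (b + + 2 * (+ 2 * i)) + + 1) - (+ 2 * b + + 1) ≡ i * + 8
      l = solve-∀
    case1 (inj₂ (i , ei)) = divides (i + b + + 1) (trans (cong (λ t → odd t + + 3 * odd b) (trans ea (cong (λ s → b + + 2 * s) ei))) (l b i))
      where
      l : ∀ b i → (+ 2 * (b + + 2 * (+ 2 * i + + 1)) + + 1) + + 3 * (+ 2 * b + + 1) ≡ (i + b + + 1) * + 8
      l = solve-∀
  ... | inj₂ (j , ej) = case2 (parity (j + b + + 1))
    where
    ea : a ≡ b + odd j
    ea = trans (la a b) (cong (λ s → b + s) ej)
      where
      la : ∀ a b → a ≡ b + (a - b)
      la = solve-∀
    case2 : (∃ λ i → j + b + + 1 ≡ + 2 * i) ⊎ (∃ λ i → j + b + + 1 ≡ odd i) → Div 8 (odd a + + 3 * odd b)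
    case2 (inj₁ (i , ei)) = ⊥-elim (n2 (divides i (trans (cong (λ t → odd t + odd b) ea) (trans (l b j) (trans (cong (+ 4 *_) ei) (l2 i))))))
      where
      l : ∀ b j → (+ 2 * (b + (+ 2 * j + + 1)) + + 1) + (+ 2 * b + + 1) ≡ + 4 * (j + b + + 1)
      l = solve-∀
      l2 : ∀ i → + 4 * (+ 2 * i) ≡ i * + 8
      l2 = solve-∀
    case2 (inj₂ (i , ei)) = ⊥-elim (n3 (divides (i - b) (trans (cong (λ t → odd t - + 3 * odd b) ea) (trans (l b j) (trans (cong (λ s → + 4 * (s - + 2 * b - + 1)) ei) (l2 b i))))))
      where
      l : ∀ b j → (+ 2 * (b + (+ 2 * j + + 1)) + + 1) - + 3 * (+ 2 * b + + 1) ≡ + 4 * ((j + b + + 1) - + 2 * b - + 1)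
      l = solve-∀
      l2 : ∀ b i → + 4 * ((+ 2 * i + + 1) - + 2 * b - + 1) ≡ (i - b) * + 8
      l2 = solve-∀

module Representations where

  -- Counting representations N = α u² + β v² inside the box [-N, N]², bijections between
  -- such counts, and the generic first step of both identities: the odd solutions of
  -- α X² + β Y² = N fall into the four classes X ≡ ±Y, ±3Y (mod 8), and Y ↦ -Y pairs
  -- the classes X ≡ Y with X ≡ -Y and X ≡ 3Y with X ≡ -3Y.

  open ListCounting
  open LatticeCounts
  open OddIntegers
  open import Data.Nat as ℕ using (ℕ; suc; _≤_; s≤s)
  import Data.Nat.Properties as NP
  open import Data.Integer as ℤ using (ℤ; +_; -[1+_]; ∣_∣; _+_; _*_; _-_; -_)
  import Data.Integer.Properties as ZP
  open import Data.Integer.Divisibility.Signed using (divides)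
  open import Data.Integer.Tactic.RingSolver using (solve-∀)
  import Data.Nat.Tactic.RingSolver as NT
  open import Data.List hiding (sum; product)
  open import Relation.Nullary
  open import Relation.Nullary.Decidable using (_×-dec_; ¬?)
  open import Relation.Unary using (Pred; Decidable)
  open import Relation.Binary.PropositionalEquality
  open import Data.Product using (_×_; _,_; ∃; proj₁; proj₂)
  open import Level using (0ℓ)

  form : ℕ → ℕ → ℤ → ℤ → ℤ
  form α β u v = + α * (u * u) + + β * (v * v)

  -- Representations of N with both variables odd, parametrised by (x, y) ↦ (2x+1, 2y+1).
  OddRep : ℕ → ℕ → ℕ → Pred (ℤ × ℤ) 0ℓ
  OddRep α β N p = form α β (odd (proj₁ p)) (odd (proj₂ p)) ≡ + N

  OddRep? : ∀ α β N → Decidable (OddRep α β N)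
  OddRep? α β N p = form α β (odd (proj₁ p)) (odd (proj₂ p)) ℤ.≟ + N

  -- Representations of N with the second variable odd, parametrised by (m, z) ↦ (m, 2z+1).
  MixedRep : ℕ → ℕ → ℕ → Pred (ℤ × ℤ) 0ℓ
  MixedRep α β N p = form α β (proj₁ p) (odd (proj₂ p)) ≡ + N

  MixedRep? : ∀ α β N → Decidable (MixedRep α β N)
  MixedRep? α β N p = form α β (proj₁ p) (odd (proj₂ p)) ℤ.≟ + N

  count : ℕ → {P : Pred (ℤ × ℤ) 0ℓ} → Decidable P → ℕ
  count R P? = length (filter P? (box R))

  InBox : ℕ → ℤ × ℤ → Set
  InBox R p = ∣ proj₁ p ∣ ≤ R × ∣ proj₂ p ∣ ≤ R

  count-bijection : ∀ R {P Q : Pred (ℤ × ℤ) 0ℓ} (P? : Decidable P) (Q? : Decidable Q) (f : ℤ × ℤ → ℤ × ℤ) →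
    (∀ {x} → P x → InBox R x) → (∀ {y} → Q y → InBox R y) →
    (∀ {x} → P x → Q (f x)) →
    (∀ {x x'} → f x ≡ f x' → x ≡ x') →
    (∀ {y} → Q y → ∃ λ x → P x × f x ≡ y) →
    count R P? ≡ count R Q?
  count-bijection R P? Q? f bP bQ into inj onto = filter-length-bijection _≟ℤ²_ P? Q? (box R) (box R) (box-unique R) (box-unique R) f
    (λ {x} _ px → let q = into px in ∈-box {R} {proj₁ (f x)} {proj₂ (f x)} (proj₁ (bQ q)) (proj₂ (bQ q)) , q)
    (λ _ _ _ _ → inj)
    (λ _ qy → let (x , px , e) = onto qy in x , ∈-box {R} {proj₁ x} {proj₂ x} (proj₁ (bP px)) (proj₂ (bP px)) , px , e)

  injective-by-scaled-inverse : ∀ (c : ℤ) {{_ : ℤ.NonZero c}} (f g : ℤ × ℤ → ℤ × ℤ) →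
    (∀ a b → g (f (a , b)) ≡ (c * a , c * b)) → ∀ {p p'} → f p ≡ f p' → p ≡ p'
  injective-by-scaled-inverse c f g h {a , b} {a' , b'} eq =
    let e = trans (sym (h a b)) (trans (cong g eq) (h a' b')) in
    cong₂ _,_ (ZP.*-cancelˡ-≡ c a a' (cong proj₁ e)) (ZP.*-cancelˡ-≡ c b b' (cong proj₂ e))

  form-ℕ : ∀ a b u v N → form a b u v ≡ + N → a ℕ.* square u ℕ.+ b ℕ.* square v ≡ N
  form-ℕ a b u v N eq = ZP.+-injective (trans (cong₂ _+_ (trans (ZP.pos-* a (square u)) (cong (+ a *_) (sym (square-ℤ u))))
                                                     (trans (ZP.pos-* b (square v)) (cong (+ b *_) (sym (square-ℤ v))))) eq)

  form-bound₁ : ∀ a b u v N → form (suc a) (suc b) u v ≡ + N → ∣ u ∣ ≤ N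
  form-bound₁ a b u v N eq =
    NP.≤-trans (≤-square ∣ u ∣) (NP.≤-trans (NP.m≤n*m (square u) (suc a))
      (subst (suc a ℕ.* square u ≤_) (form-ℕ (suc a) (suc b) u v N eq) (NP.m≤m+n _ _)))

  form-bound₂ : ∀ a b u v N → form (suc a) (suc b) u v ≡ + N → ∣ v ∣ ≤ N
  form-bound₂ a b u v N eq =
    NP.≤-trans (≤-square ∣ v ∣) (NP.≤-trans (NP.m≤n*m (square v) (suc b))
      (subst (suc b ℕ.* square v ≤_) (form-ℕ (suc a) (suc b) u v N eq) (NP.m≤n+m (suc b ℕ.* square v) (suc a ℕ.* square u))))

  ∣∣≤∣odd∣ : ∀ z → ∣ z ∣ ≤ ∣ odd z ∣
  ∣∣≤∣odd∣ (+ k) = subst (k ≤_) (cong ∣_∣ (cong (_+ + 1) (ZP.pos-* 2 k))) (NP.≤-trans (NP.m≤n*m k 2) (NP.m≤m+n _ 1))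
  ∣∣≤∣odd∣ -[1+ k ] = subst (suc k ≤_) (sym (trans (cong ∣_∣ (l (+ k))) (ZP.∣-i∣≡∣i∣ (+ 2 * + k + + 1)))) (subst (suc k ≤_) (cong ∣_∣ (cong (_+ + 1) (ZP.pos-* 2 k))) h)
    where
    l : ∀ w → + 2 * (- (+ 1 + w)) + + 1 ≡ - (+ 2 * w + + 1)
    l = solve-∀
    h : suc k ≤ 2 ℕ.* k ℕ.+ 1
    h = subst (suc k ≤_) (NP.+-comm 1 (2 ℕ.* k)) (s≤s (NP.m≤n*m k 2))

  odd-in-box : ∀ a b N {x y} → form (suc a) (suc b) (odd x) (odd y) ≡ + N → InBox N (x , y)
  odd-in-box a b N {x} {y} e =
    NP.≤-trans (∣∣≤∣odd∣ x) (form-bound₁ a b (odd x) (odd y) N e) ,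
    NP.≤-trans (∣∣≤∣odd∣ y) (form-bound₂ a b (odd x) (odd y) N e)

  mixed-in-box : ∀ a b N {m z} → form (suc a) (suc b) m (odd z) ≡ + N → InBox N (m , z)
  mixed-in-box a b N {m} {z} e =
    form-bound₁ a b m (odd z) N e , NP.≤-trans (∣∣≤∣odd∣ z) (form-bound₂ a b m (odd z) N e)

  solve-sub : ∀ X Y W → X - Y ≡ W → X ≡ W + Y
  solve-sub X Y W eq = trans (l X Y) (cong (_+ Y) eq)
    where
    l : ∀ X Y → X ≡ (X - Y) + Y
    l = solve-∀

  solve-add : ∀ X W E → X + W ≡ E → X ≡ E - W
  solve-add X W E eq = trans (l X W) (cong (_- W) eq)
    where
    l : ∀ X W → X ≡ (X + W) - W
    l = solve-∀

  EvenSumRep OddSumRep : ℕ → ℕ → ℕ → Pred (ℤ × ℤ) 0ℓ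
  EvenSumRep α β N p = OddRep α β N p × Div 2 (proj₁ p + proj₂ p)
  OddSumRep α β N p = OddRep α β N p × ¬ Div 2 (proj₁ p + proj₂ p)

  EvenSumRep? : ∀ α β N → Decidable (EvenSumRep α β N)
  EvenSumRep? α β N p = OddRep? α β N p ×-dec Div? 2 (proj₁ p + proj₂ p)

  OddSumRep? : ∀ α β N → Decidable (OddSumRep α β N)
  OddSumRep? α β N p = OddRep? α β N p ×-dec ¬? (Div? 2 (proj₁ p + proj₂ p))

  sum-parity-split : ∀ α β N → count N (OddRep? α β N) ≡ count N (EvenSumRep? α β N) ℕ.+ count N (OddSumRep? α β N)
  sum-parity-split α β N = filter-length-split (OddRep? α β N) (λ p → Div? 2 (proj₁ p + proj₂ p)) (box N)

  -- The reflection y ↦ -1-y fixes (2y+1)² and changes the parity of x + y,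
  -- so both halves have the same size.
  reflect : ℤ × ℤ → ℤ × ℤ
  reflect p = proj₁ p , - proj₂ p - + 1

  even-sum≡odd-sum : ∀ a b N → count N (EvenSumRep? (suc a) (suc b) N) ≡ count N (OddSumRep? (suc a) (suc b) N)
  even-sum≡odd-sum a b N =
    count-bijection N (EvenSumRep? α β N) (OddSumRep? α β N) reflect
      (λ {p} c → odd-in-box a b N {proj₁ p} {proj₂ p} (proj₁ c)) (λ {p} c → odd-in-box a b N {proj₁ p} {proj₂ p} (proj₁ c))
      (λ {p} → into {p}) (injective-by-scaled-inverse (+ 1) reflect reflect (λ x y → cong₂ _,_ (unit x) (involution y)))
      (λ {p} → onto {p})
    where
    α β : ℕ
    α = suc a
    β = suc b
    unit : ∀ x → x ≡ + 1 * x
    unit = solve-∀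
    involution : ∀ y → - (- y - + 1) - + 1 ≡ + 1 * y
    involution = solve-∀
    reflected-form : ∀ x y → form α β (odd x) (odd (- y - + 1)) ≡ form α β (odd x) (odd y)
    reflected-form x y = cong (λ t → + α * (odd x * odd x) + + β * t) (same-square y)
      where
      same-square : ∀ y → (+ 2 * (- y - + 1) + + 1) * (+ 2 * (- y - + 1) + + 1) ≡ (+ 2 * y + + 1) * (+ 2 * y + + 1)
      same-square = solve-∀
    shifted-sum : ∀ x y → x + (- y - + 1) ≡ (x + y) - + 2 * y - + 1
    shifted-sum = solve-∀
    into : ∀ {p} → EvenSumRep α β N p → OddSumRep α β N (reflect p)
    into {x , y} (e , divides w ew) =
      trans (reflected-form x y) e ,
      odd-not-even (w - y - + 1) (trans (shifted-sum x y) (trans (cong (λ t → t - + 2 * y - + 1) ew) (regroup w y)))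
      where
      regroup : ∀ w y → w * + 2 - + 2 * y - + 1 ≡ + 2 * (w - y - + 1) + + 1
      regroup = solve-∀
    onto : ∀ {p} → OddSumRep α β N p → ∃ λ q → EvenSumRep α β N q × reflect q ≡ p
    onto {x , y} (e , x+y-odd) with not-even-odd (x + y) x+y-odd
    ... | j , ej = (x , - y - + 1) ,
          (trans (reflected-form x y) e , divides (j - y) (trans (shifted-sum x y) (trans (cong (λ t → t - + 2 * y - + 1) ej) (regroup j y)))) ,
          cong (x ,_) (involutive y)
      where
      regroup : ∀ j y → (+ 2 * j + + 1) - + 2 * y - + 1 ≡ (j - y) * + 2
      regroup = solve-∀
      involutive : ∀ y → - (- y - + 1) - + 1 ≡ y
      involutive = solve-∀

  -- The residue-class decomposition of the odd solutions of (a'+1) X² + (b'+1) Y² = N: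
  -- OddSol are the odd solutions (X, Y) themselves, C1 – C4 the classes X ≡ Y, -Y, 3Y, -3Y
  -- (mod 8), Rest₁, Rest₂ the intermediate complements.
  module ResidueSplit (a' b' N : ℕ) where
    α β : ℕ
    α = suc a'
    β = suc b'

    OddParam : Pred (ℤ × ℤ) 0ℓ
    OddParam = OddRep α β N
    OddParam? : Decidable OddParam
    OddParam? = OddRep? α β N

    OddSol : Pred (ℤ × ℤ) 0ℓ
    OddSol p = Odd (proj₁ p) × (Odd (proj₂ p) × form α β (proj₁ p) (proj₂ p) ≡ + N)
    OddSol? : Decidable OddSol
    OddSol? p = Odd? (proj₁ p) ×-dec (Odd? (proj₂ p) ×-dec (form α β (proj₁ p) (proj₂ p) ℤ.≟ + N))

    A1 A2 A3 : Pred (ℤ × ℤ) 0ℓ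
    A1 p = Div 8 (proj₁ p - proj₂ p)
    A2 p = Div 8 (proj₁ p + proj₂ p)
    A3 p = Div 8 (proj₁ p - + 3 * proj₂ p)
    A1? : Decidable A1
    A1? p = Div? 8 (proj₁ p - proj₂ p)
    A2? : Decidable A2
    A2? p = Div? 8 (proj₁ p + proj₂ p)
    A3? : Decidable A3
    A3? p = Div? 8 (proj₁ p - + 3 * proj₂ p)

    -- Peel off the classes one at a time; C4 is X ≡ -3Y by residue-cover.
    C1 Rest₁ C2 Rest₂ C3 C4 : Pred (ℤ × ℤ) 0ℓ
    C1 p = OddSol p × A1 p
    Rest₁ p = OddSol p × ¬ A1 p
    C2 p = Rest₁ p × A2 p
    Rest₂ p = Rest₁ p × ¬ A2 p
    C3 p = Rest₂ p × A3 p
    C4 p = Rest₂ p × ¬ A3 p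
    C1? : Decidable C1
    C1? p = OddSol? p ×-dec A1? p
    Rest₁? : Decidable Rest₁
    Rest₁? p = OddSol? p ×-dec ¬? (A1? p)
    C2? : Decidable C2
    C2? p = Rest₁? p ×-dec A2? p
    Rest₂? : Decidable Rest₂
    Rest₂? p = Rest₁? p ×-dec ¬? (A2? p)
    C3? : Decidable C3
    C3? p = Rest₂? p ×-dec A3? p
    C4? : Decidable C4
    C4? p = Rest₂? p ×-dec ¬? (A3? p)

    OddSol-in-box : ∀ {p} → OddSol p → InBox N p
    OddSol-in-box {X , Y} (_ , _ , e) = form-bound₁ a' b' X Y N e , form-bound₂ a' b' X Y N e

    form-neg : ∀ X Y → form α β X (- Y) ≡ form α β X Y
    form-neg X Y = cong (λ t → + α * (X * X) + + β * t) (neg-square Y)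
      where
      neg-square : ∀ Y → (- Y) * (- Y) ≡ Y * Y
      neg-square = solve-∀

    OddSol-neg : ∀ {X Y} → OddSol (X , Y) → OddSol (X , - Y)
    OddSol-neg {X} {Y} (ox , oy , e) = ox , Odd-neg {Y} oy , trans (form-neg X Y) e

    params≡sols : count N OddParam? ≡ count N OddSol?
    params≡sols = count-bijection N OddParam? OddSol? (λ p → odd (proj₁ p) , odd (proj₂ p)) (λ {p} → odd-in-box a' b' N {proj₁ p} {proj₂ p}) (λ {p} → OddSol-in-box {p})
      (λ {p} e → Odd-odd (proj₁ p) , Odd-odd (proj₂ p) , e)
      (injective-by-scaled-inverse (+ 2) _ (λ p → proj₁ p - + 1 , proj₂ p - + 1) (λ a b → cong₂ _,_ (pred-odd a) (pred-odd b)))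
      onto
      where
      pred-odd : ∀ a → (+ 2 * a + + 1) - + 1 ≡ + 2 * a
      pred-odd = solve-∀
      onto : ∀ {y} → OddSol y → ∃ λ x → OddParam x × (odd (proj₁ x) , odd (proj₂ x)) ≡ y
      onto {X , Y} (ox , oy , e) with Odd⇒odd {X} ox | Odd⇒odd {Y} oy
      ... | a , refl | b , refl = (a , b) , e , refl

    flip-injective : ∀ {x x'} → (proj₁ x , - proj₂ x) ≡ (proj₁ x' , - proj₂ x') → x ≡ x'
    flip-injective = injective-by-scaled-inverse (+ 1) (λ p → proj₁ p , - proj₂ p) (λ p → proj₁ p , - proj₂ p) (λ a b → cong₂ _,_ (unit a) (involution b))
      where
      unit : ∀ a → a ≡ + 1 * a
      unit = solve-∀
      involution : ∀ b → - - b ≡ + 1 * b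
      involution = solve-∀

    sub-neg : ∀ X Y → X - - Y ≡ X + Y
    sub-neg = solve-∀
    add-neg : ∀ X Y → X + - Y ≡ X - Y
    add-neg = solve-∀
    sub-triple-neg : ∀ X Y → X - + 3 * - Y ≡ X + + 3 * Y
    sub-triple-neg = solve-∀

    -- Y ↦ -Y maps the class X ≡ Y onto X ≡ -Y (disjointness by not-both-±mod8) ...
    C1→C2 : count N C1? ≡ count N C2?
    C1→C2 = count-bijection N C1? C2? (λ p → proj₁ p , - proj₂ p) (λ {p} c → OddSol-in-box {p} (proj₁ c)) (λ {p} c → OddSol-in-box {p} (proj₁ (proj₁ c)))
      (λ {p} (so , a1) → (OddSol-neg {proj₁ p} {proj₂ p} so , subst (λ E → ¬ Div 8 E) (sym (sub-neg (proj₁ p) (proj₂ p))) (λ a2 → not-both-±mod8 (proj₁ p) (proj₂ p) (proj₁ (proj₂ so)) a1 a2)) ,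
                         subst (Div 8) (sym (add-neg (proj₁ p) (proj₂ p))) a1)
      flip-injective onto
      where
      onto : ∀ {y} → C2 y → ∃ λ x → C1 x × (proj₁ x , - proj₂ x) ≡ y
      onto {X , Y} ((so , _) , a2) = (X , - Y) , (OddSol-neg {X} {Y} so , subst (Div 8) (sym (sub-neg X Y)) a2) , cong (X ,_) (ZP.neg-involutive Y)

    C3→C4 : count N C3? ≡ count N C4?
    C3→C4 = count-bijection N C3? C4? (λ p → proj₁ p , - proj₂ p) (λ {p} c → OddSol-in-box {p} (proj₁ (proj₁ (proj₁ c)))) (λ {p} c → OddSol-in-box {p} (proj₁ (proj₁ (proj₁ c))))
      (λ {p} (((so , n1) , n2) , a3) → ((OddSol-neg {proj₁ p} {proj₂ p} so , subst (λ E → ¬ Div 8 E) (sym (sub-neg (proj₁ p) (proj₂ p))) n2) , subst (λ E → ¬ Div 8 E) (sym (add-neg (proj₁ p) (proj₂ p))) n1) ,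
                         subst (λ E → ¬ Div 8 E) (sym (sub-triple-neg (proj₁ p) (proj₂ p))) (λ a4 → not-both-±mod8 (proj₁ p) (+ 3 * proj₂ p) (Odd-triple {proj₂ p} (proj₁ (proj₂ so))) a3 a4))
      flip-injective onto
      where
      onto : ∀ {y} → C4 y → ∃ λ x → C3 x × (proj₁ x , - proj₂ x) ≡ y
      onto {X , Y} (((so , n1) , n2) , n3) =
        (X , - Y) , (((OddSol-neg {X} {Y} so , subst (λ E → ¬ Div 8 E) (sym (sub-neg X Y)) n2) , subst (λ E → ¬ Div 8 E) (sym (add-neg X Y)) n1) ,
                     subst (Div 8) (sym (sub-triple-neg X Y)) (residue-cover {X} {Y} (proj₁ so) (proj₁ (proj₂ so)) n1 n2 n3)) , cong (X ,_) (ZP.neg-involutive Y)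

    split-count : count N OddParam? ≡ 2 ℕ.* count N C1? ℕ.+ 2 ℕ.* count N C3?
    split-count = begin
        count N OddParam?
      ≡⟨ params≡sols ⟩
        count N OddSol?
      ≡⟨ filter-length-split OddSol? A1? (box N) ⟩
        count N C1? ℕ.+ count N Rest₁?
      ≡⟨ cong (count N C1? ℕ.+_) (filter-length-split Rest₁? A2? (box N)) ⟩
        count N C1? ℕ.+ (count N C2? ℕ.+ count N Rest₂?)
      ≡⟨ cong (λ t → count N C1? ℕ.+ (count N C2? ℕ.+ t)) (filter-length-split Rest₂? A3? (box N)) ⟩
        count N C1? ℕ.+ (count N C2? ℕ.+ (count N C3? ℕ.+ count N C4?))
      ≡⟨ cong₂ (λ s t → count N C1? ℕ.+ (s ℕ.+ (count N C3? ℕ.+ t))) (sym C1→C2) (sym C3→C4) ⟩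
        count N C1? ℕ.+ (count N C1? ℕ.+ (count N C3? ℕ.+ count N C3?))
      ≡⟨ ar (count N C1?) (count N C3?) ⟩
        2 ℕ.* count N C1? ℕ.+ 2 ℕ.* count N C3?
      ∎
      where
      open ≡-Reasoning
      ar : ∀ a b → a ℕ.+ (a ℕ.+ (b ℕ.+ b)) ≡ 2 ℕ.* a ℕ.+ 2 ℕ.* b
      ar = NT.solve-∀

module ThetaTerms where

  -- Since (2z+1)² = 8·T(z) + 1,
  -- a lattice point has weight a + k₁x² + k₂T(y) = n exactly when (x, 2y+1) represents
  -- 8n + c by a suitable form α X² + β Y²; similarly for two triangular weights.

  open import Defs
  open ListCounting
  open LatticeCounts
  open OddIntegers
  open Representations
  open import Data.Nat as ℕ using (ℕ; suc; _<_; NonZero)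
  import Data.Nat.Properties as NP
  import Data.Nat.Tactic.RingSolver as NT
  open import Data.Integer as ℤ using (ℤ; +_; -[1+_]; _+_; _*_; -_)
  import Data.Integer.Properties as ZP
  open import Data.Integer.Tactic.RingSolver using (solve-∀)
  open import Data.List using (length; filter)
  open import Relation.Binary.PropositionalEquality
  open import Data.Product using (_×_; _,_; proj₁; proj₂)

  odd-square-ℕ : ∀ k → odd (+ k) * odd (+ k) ≡ + (8 ℕ.* triangle k ℕ.+ 1)
  odd-square-ℕ k = begin
      odd (+ k) * odd (+ k)                    ≡⟨ cong (λ t → (t + + 1) * (t + + 1)) (ZP.pos-* 2 k) ⟨
      + (2 ℕ.* k ℕ.+ 1) * + (2 ℕ.* k ℕ.+ 1)    ≡⟨ ZP.pos-* (2 ℕ.* k ℕ.+ 1) (2 ℕ.* k ℕ.+ 1) ⟨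
      + ((2 ℕ.* k ℕ.+ 1) ℕ.* (2 ℕ.* k ℕ.+ 1))  ≡⟨ cong +_ (expand k) ⟩
      + (4 ℕ.* (k ℕ.* suc k) ℕ.+ 1)            ≡⟨ cong (λ t → + (4 ℕ.* t ℕ.+ 1)) (twice-triangle k) ⟨
      + (4 ℕ.* (2 ℕ.* triangle k) ℕ.+ 1)       ≡⟨ cong +_ (regroup (triangle k)) ⟩
      + (8 ℕ.* triangle k ℕ.+ 1)               ∎
    where
    open ≡-Reasoning
    expand : ∀ k → (2 ℕ.* k ℕ.+ 1) ℕ.* (2 ℕ.* k ℕ.+ 1) ≡ 4 ℕ.* (k ℕ.* suc k) ℕ.+ 1
    expand = NT.solve-∀
    regroup : ∀ t → 4 ℕ.* (2 ℕ.* t) ℕ.+ 1 ≡ 8 ℕ.* t ℕ.+ 1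
    regroup = NT.solve-∀

  -- ... and the same holds for negative z since (2(-1-k)+1)² = (2k+1)².
  odd-square : ∀ z → odd z * odd z ≡ + (8 ℕ.* triangular z ℕ.+ 1)
  odd-square (+ k) = odd-square-ℕ k
  odd-square -[1+ k ] = trans (mirror (+ k)) (odd-square-ℕ k)
    where
    mirror : ∀ w → (+ 2 * (- (+ 1 + w)) + + 1) * (+ 2 * (- (+ 1 + w)) + + 1) ≡ (+ 2 * w + + 1) * (+ 2 * w + + 1)
    mirror = solve-∀

  form-cast : ∀ α β u v A B → u * u ≡ + A → v * v ≡ + B → form α β u v ≡ + (α ℕ.* A ℕ.+ β ℕ.* B)
  form-cast α β u v A B eu ev =
    trans (cong₂ (λ s t → + α * s + + β * t) eu ev) (cong₂ _+_ (sym (ZP.pos-* α A)) (sym (ZP.pos-* β B)))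

  weight-to-form : ∀ (S : ℤ × ℤ → ℕ) (E : ℤ × ℤ → ℤ) (c n R : ℕ) → (∀ p → E p ≡ + (8 ℕ.* S p ℕ.+ c)) →
    length (filter (λ p → S p ℕ.≟ n) (box R)) ≡ length (filter (λ p → E p ℤ.≟ + (8 ℕ.* n ℕ.+ c)) (box R))
  weight-to-form S E c n R h = filter-length-cong (λ p → S p ℕ.≟ n) (λ p → E p ℤ.≟ + (8 ℕ.* n ℕ.+ c)) (box R)
    (λ p e → trans (h p) (cong (λ t → + (8 ℕ.* t ℕ.+ c)) e))
    (λ p e → NP.*-cancelˡ-≡ (S p) n 8 (NP.+-cancelʳ-≡ c _ _ (ZP.+-injective (trans (sym (h p)) e))))

  mixed-weight : ∀ α β c (w : ℕ → ℕ → ℕ) → (∀ s t → α ℕ.* s ℕ.+ β ℕ.* (8 ℕ.* t ℕ.+ 1) ≡ 8 ℕ.* w s t ℕ.+ c) →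
    ∀ p → form α β (proj₁ p) (odd (proj₂ p)) ≡ + (8 ℕ.* w (square (proj₁ p)) (triangular (proj₂ p)) ℕ.+ c)
  mixed-weight α β c w ar (m , z) =
    trans (form-cast α β m (odd z) (square m) (8 ℕ.* triangular z ℕ.+ 1) (square-ℤ m) (odd-square z))
          (cong +_ (ar (square m) (triangular z)))

  odd-weight : ∀ α β c (w : ℕ → ℕ → ℕ) → (∀ s t → α ℕ.* (8 ℕ.* s ℕ.+ 1) ℕ.+ β ℕ.* (8 ℕ.* t ℕ.+ 1) ≡ 8 ℕ.* w s t ℕ.+ c) →
    ∀ p → form α β (odd (proj₁ p)) (odd (proj₂ p)) ≡ + (8 ℕ.* w (triangular (proj₁ p)) (triangular (proj₂ p)) ℕ.+ c)
  odd-weight α β c w ar (x , y) =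
    trans (form-cast α β (odd x) (odd y) _ _ (odd-square x) (odd-square y)) (cong +_ (ar (triangular x) (triangular y)))

  module Terms (n N : ℕ) (n<N : n < N) where

    ψ-dil : ∀ k .{{_ : NonZero k}} → Models 2 (dil k ψ) (λ x → k ℕ.* triangular x) N
    ψ-dil k = dil-models 2 ψ triangular N k (ψ-models N)

    φ-dil : ∀ k .{{_ : NonZero k}} → Models 1 (dil k φ) (λ x → k ℕ.* square x) N
    φ-dil k = dil-models 1 φ square N k (φ-models N)

    ψψ-term : ∀ k₁ k₂ .{{_ : NonZero k₁}} .{{_ : NonZero k₂}} α β c →
      (∀ s t → α ℕ.* (8 ℕ.* s ℕ.+ 1) ℕ.+ β ℕ.* (8 ℕ.* t ℕ.+ 1) ≡ 8 ℕ.* (k₁ ℕ.* s ℕ.+ k₂ ℕ.* t) ℕ.+ c) →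
      4 ℕ.* (dil k₁ ψ ⊛ dil k₂ ψ) n ≡ count N (OddRep? α β (8 ℕ.* n ℕ.+ c))
    ψψ-term k₁ k₂ α β c ar =
      trans (product-count 2 2 (dil k₁ ψ) (dil k₂ ψ) (λ x → k₁ ℕ.* triangular x) (λ y → k₂ ℕ.* triangular y) N n (ψ-dil k₁) (ψ-dil k₂) n<N)
            (weight-to-form _ _ c n N (odd-weight α β c (λ s t → k₁ ℕ.* s ℕ.+ k₂ ℕ.* t) ar))

    ψψ-shifted : ∀ a k₁ k₂ .{{_ : NonZero k₁}} .{{_ : NonZero k₂}} α β c →
      (∀ s t → α ℕ.* (8 ℕ.* s ℕ.+ 1) ℕ.+ β ℕ.* (8 ℕ.* t ℕ.+ 1) ≡ 8 ℕ.* (a ℕ.+ (k₁ ℕ.* s ℕ.+ k₂ ℕ.* t)) ℕ.+ c) →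
      4 ℕ.* shift a (dil k₁ ψ ⊛ dil k₂ ψ) n ≡ count N (OddRep? α β (8 ℕ.* n ℕ.+ c))
    ψψ-shifted a k₁ k₂ α β c ar =
      trans (shifted-product-count 2 2 (dil k₁ ψ) (dil k₂ ψ) (λ x → k₁ ℕ.* triangular x) (λ y → k₂ ℕ.* triangular y) N a n (ψ-dil k₁) (ψ-dil k₂) n<N)
            (weight-to-form _ _ c n N (odd-weight α β c (λ s t → a ℕ.+ (k₁ ℕ.* s ℕ.+ k₂ ℕ.* t)) ar))

    φψ-term : ∀ k₁ k₂ .{{_ : NonZero k₁}} .{{_ : NonZero k₂}} α β c →
      (∀ s t → α ℕ.* s ℕ.+ β ℕ.* (8 ℕ.* t ℕ.+ 1) ≡ 8 ℕ.* (k₁ ℕ.* s ℕ.+ k₂ ℕ.* t) ℕ.+ c) →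
      2 ℕ.* (dil k₁ φ ⊛ dil k₂ ψ) n ≡ count N (MixedRep? α β (8 ℕ.* n ℕ.+ c))
    φψ-term k₁ k₂ α β c ar =
      trans (product-count 1 2 (dil k₁ φ) (dil k₂ ψ) (λ x → k₁ ℕ.* square x) (λ y → k₂ ℕ.* triangular y) N n (φ-dil k₁) (ψ-dil k₂) n<N)
            (weight-to-form _ _ c n N (mixed-weight α β c (λ s t → k₁ ℕ.* s ℕ.+ k₂ ℕ.* t) ar))

    φψ-shifted : ∀ a k₁ k₂ .{{_ : NonZero k₁}} .{{_ : NonZero k₂}} α β c →
      (∀ s t → α ℕ.* s ℕ.+ β ℕ.* (8 ℕ.* t ℕ.+ 1) ≡ 8 ℕ.* (a ℕ.+ (k₁ ℕ.* s ℕ.+ k₂ ℕ.* t)) ℕ.+ c) →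
      2 ℕ.* shift a (dil k₁ φ ⊛ dil k₂ ψ) n ≡ count N (MixedRep? α β (8 ℕ.* n ℕ.+ c))
    φψ-shifted a k₁ k₂ α β c ar =
      trans (shifted-product-count 1 2 (dil k₁ φ) (dil k₂ ψ) (λ x → k₁ ℕ.* square x) (λ y → k₂ ℕ.* triangular y) N a n (φ-dil k₁) (ψ-dil k₂) n<N)
            (weight-to-form _ _ c n N (mixed-weight α β c (λ s t → a ℕ.+ (k₁ ℕ.* s ℕ.+ k₂ ℕ.* t)) ar))

module SecondReduction (N : ℕ) where

  -- Pi is the form belonging to the
  -- i-th term of the identity.  Each class of ResidueSplit 0 14 N is refined by a congruence
  -- mod 16 or 32 and every refined class is matched with one Pi by an explicit linear map.

  open ListCounting
  open LatticeCounts
  open OddIntegers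
  open Representations
  open import Data.Nat as ℕ using (ℕ)
  import Data.Nat.Properties as NP
  open import Data.Integer using (ℤ; +_; _+_; _*_; _-_)
  open import Data.Integer.Divisibility.Signed using (divides)
  open import Data.Integer.Tactic.RingSolver using (solve-∀)
  import Data.Nat.Tactic.RingSolver as NT
  open import Relation.Nullary
  open import Relation.Nullary.Decidable using (_×-dec_; ¬?)
  open import Relation.Unary using (Pred; Decidable)
  open import Relation.Binary.PropositionalEquality
  open import Data.Product using (_×_; _,_; ∃; proj₁; proj₂)
  open import Data.Sum using (inj₁; inj₂)
  open import Data.Empty using (⊥-elim)
  open import Level using (0ℓ)

  open ResidueSplit 0 14 N public

  B16 B32 E16 : Pred (ℤ × ℤ) 0ℓ
  B16 p = Div 16 (proj₁ p - proj₂ p)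
  B32 p = Div 32 (proj₁ p - proj₂ p)
  E16 p = Div 16 (proj₁ p - + 3 * proj₂ p)
  B16? : Decidable B16
  B16? p = Div? 16 (proj₁ p - proj₂ p)
  B32? : Decidable B32
  B32? p = Div? 32 (proj₁ p - proj₂ p)
  E16? : Decidable E16
  E16? p = Div? 16 (proj₁ p - + 3 * proj₂ p)

  C1c C1ab C1a C1b C3a C3b : Pred (ℤ × ℤ) 0ℓ
  C1c p = C1 p × ¬ B16 p
  C1ab p = C1 p × B16 p
  C1a p = C1ab p × B32 p
  C1b p = C1ab p × ¬ B32 p
  C3a p = C3 p × E16 p
  C3b p = C3 p × ¬ E16 p
  C1c? : Decidable C1c
  C1c? p = C1? p ×-dec ¬? (B16? p)
  C1ab? : Decidable C1ab
  C1ab? p = C1? p ×-dec B16? p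
  C1a? : Decidable C1a
  C1a? p = C1ab? p ×-dec B32? p
  C1b? : Decidable C1b
  C1b? p = C1ab? p ×-dec ¬? (B32? p)
  C3a? : Decidable C3a
  C3a? p = C3? p ×-dec E16? p
  C3b? : Decidable C3b
  C3b? p = C3? p ×-dec ¬? (E16? p)

  P1 : Pred (ℤ × ℤ) 0ℓ
  P1 = MixedRep 960 16 N
  P1? : Decidable P1
  P1? = MixedRep? 960 16 N

  f1 : ℤ × ℤ → ℤ × ℤ
  f1 p = odd (proj₂ p) + + 30 * proj₁ p , odd (proj₂ p) - + 2 * proj₁ p

  -- (m, Z) ↦ (Z + 30m, Z - 2m) matches term 1 with X ≡ Y (mod 32), as X - Y = 32m.
  P1→C1a : count N P1? ≡ count N C1a?
  P1→C1a = count-bijection N P1? C1a? f1 (λ {p} → mixed-in-box 959 15 N {proj₁ p} {proj₂ p})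
    (λ {p} c → OddSol-in-box {p} (proj₁ (proj₁ (proj₁ c))))
    (λ {p} → into {p}) (injective-by-scaled-inverse (+ 32) f1 (λ p → proj₁ p - proj₂ p , proj₁ p + + 15 * proj₂ p - + 16) (λ m z → cong₂ _,_ (undo₁ m z) (undo₂ m z))) (λ {y} → onto {y})
    where
    form-identity : ∀ m Z → + 1 * ((Z + + 30 * m) * (Z + + 30 * m)) + + 15 * ((Z - + 2 * m) * (Z - + 2 * m)) ≡ + 960 * (m * m) + + 16 * (Z * Z)
    form-identity = solve-∀
    undo₁ : ∀ m z → ((+ 2 * z + + 1) + + 30 * m) - ((+ 2 * z + + 1) - + 2 * m) ≡ + 32 * m
    undo₁ = solve-∀
    undo₂ : ∀ m z → ((+ 2 * z + + 1) + + 30 * m) + + 15 * ((+ 2 * z + + 1) - + 2 * m) - + 16 ≡ + 32 * z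
    undo₂ = solve-∀
    odd-X : ∀ m z → + 2 * (z + + 15 * m) + + 1 ≡ (+ 2 * z + + 1) + + 30 * m
    odd-X = solve-∀
    odd-Y : ∀ m z → + 2 * (z - m) + + 1 ≡ (+ 2 * z + + 1) - + 2 * m
    odd-Y = solve-∀
    into : ∀ {p} → P1 p → C1a (f1 p)
    into {m , z} e = (((subst Odd (odd-X m z) (Odd-odd (z + + 15 * m)) , subst Odd (odd-Y m z) (Odd-odd (z - m)) , trans (form-identity m (odd z)) e) ,
                      divides (+ 4 * m) (l8 m z)) , divides (+ 2 * m) (l16 m z)) , divides m (l32 m z)
      where
      l8 : ∀ m z → ((+ 2 * z + + 1) + + 30 * m) - ((+ 2 * z + + 1) - + 2 * m) ≡ (+ 4 * m) * + 8
      l8 = solve-∀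
      l16 : ∀ m z → ((+ 2 * z + + 1) + + 30 * m) - ((+ 2 * z + + 1) - + 2 * m) ≡ (+ 2 * m) * + 16
      l16 = solve-∀
      l32 : ∀ m z → ((+ 2 * z + + 1) + + 30 * m) - ((+ 2 * z + + 1) - + 2 * m) ≡ m * + 32
      l32 = solve-∀
    onto : ∀ {y} → C1a y → ∃ λ x → P1 x × f1 x ≡ y
    onto {X , Y} ((((ox , oy , e) , _) , _) , divides q eq) with Odd⇒odd {Y} oy
    ... | b , refl = (q , b + q) , trans (sym (form-identity q (odd (b + q)))) (trans (cong (λ p → form 1 15 (proj₁ p) (proj₂ p)) hits) e) , hits
      where
      hits : f1 (q , b + q) ≡ (X , odd b)
      hits = cong₂ _,_ (trans (coord₁ q b) (sym (solve-sub X (odd b) (q * + 32) eq))) (coord₂ q b)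
        where
        coord₁ : ∀ q b → (+ 2 * (b + q) + + 1) + + 30 * q ≡ q * + 32 + (+ 2 * b + + 1)
        coord₁ = solve-∀
        coord₂ : ∀ q b → (+ 2 * (b + q) + + 1) - + 2 * q ≡ + 2 * b + + 1
        coord₂ = solve-∀

  P2 : Pred (ℤ × ℤ) 0ℓ
  P2 = MixedRep 64 240 N
  P2? : Decidable P2
  P2? = MixedRep? 64 240 N

  f2 : ℤ × ℤ → ℤ × ℤ
  f2 p = + 2 * proj₁ p + + 15 * odd (proj₂ p) , + 2 * proj₁ p - odd (proj₂ p)

  -- (m, Z) ↦ (2m + 15Z, 2m - Z) matches term 2 with X ≡ Y (mod 16) but not (mod 32), as X - Y = 16Z.
  P2→C1b : count N P2? ≡ count N C1b?
  P2→C1b = count-bijection N P2? C1b? f2 (λ {p} → mixed-in-box 63 239 N {proj₁ p} {proj₂ p})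
    (λ {p} c → OddSol-in-box {p} (proj₁ (proj₁ (proj₁ c))))
    (λ {p} → into {p}) (injective-by-scaled-inverse (+ 32) f2 (λ p → proj₁ p + + 15 * proj₂ p , proj₁ p - proj₂ p - + 16) (λ m z → cong₂ _,_ (undo₁ m z) (undo₂ m z))) (λ {y} → onto {y})
    where
    form-identity : ∀ m Z → + 1 * ((+ 2 * m + + 15 * Z) * (+ 2 * m + + 15 * Z)) + + 15 * ((+ 2 * m - Z) * (+ 2 * m - Z)) ≡ + 64 * (m * m) + + 240 * (Z * Z)
    form-identity = solve-∀
    undo₁ : ∀ m z → (+ 2 * m + + 15 * (+ 2 * z + + 1)) + + 15 * (+ 2 * m - (+ 2 * z + + 1)) ≡ + 32 * m
    undo₁ = solve-∀
    undo₂ : ∀ m z → (+ 2 * m + + 15 * (+ 2 * z + + 1)) - (+ 2 * m - (+ 2 * z + + 1)) - + 16 ≡ + 32 * z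
    undo₂ = solve-∀
    odd-X : ∀ m z → + 2 * (m + + 15 * z + + 7) + + 1 ≡ + 2 * m + + 15 * (+ 2 * z + + 1)
    odd-X = solve-∀
    odd-Y : ∀ m z → + 2 * (m - z - + 1) + + 1 ≡ + 2 * m - (+ 2 * z + + 1)
    odd-Y = solve-∀
    difference : ∀ m Z → (+ 2 * m + + 15 * Z) - (+ 2 * m - Z) ≡ + 16 * Z
    difference = solve-∀
    into : ∀ {p} → P2 p → C1b (f2 p)
    into {m , z} e = (((subst Odd (odd-X m z) (Odd-odd (m + + 15 * z + + 7)) , subst Odd (odd-Y m z) (Odd-odd (m - z - + 1)) , trans (form-identity m (odd z)) e) ,
                      divides (+ 2 * odd z) (trans (difference m (odd z)) (l8 (odd z)))) , divides (odd z) (trans (difference m (odd z)) (l16 (odd z)))) ,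
                      not-double-divides 16 z _ (difference m (odd z))
      where
      l8 : ∀ Z → + 16 * Z ≡ (+ 2 * Z) * + 8
      l8 = solve-∀
      l16 : ∀ Z → + 16 * Z ≡ Z * + 16
      l16 = solve-∀
    onto : ∀ {y} → C1b y → ∃ λ x → P2 x × f2 x ≡ y
    onto {X , Y} ((((ox , oy , e) , _) , divides q eq) , n32) with Odd⇒odd {Y} oy | parity q
    ... | b , refl | inj₁ (j , refl) = ⊥-elim (n32 (even-quotient 16 j eq))
    ... | b , refl | inj₂ (j , refl) = (b + j + + 1 , j) , trans (sym (form-identity (b + j + + 1) (odd j))) (trans (cong (λ p → form 1 15 (proj₁ p) (proj₂ p)) hits) e) , hits
      where
      hits : f2 (b + j + + 1 , j) ≡ (X , odd b)
      hits = cong₂ _,_ (trans (coord₁ b j) (sym (solve-sub X (odd b) (odd j * + 16) eq))) (coord₂ b j)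
        where
        coord₁ : ∀ b j → + 2 * (b + j + + 1) + + 15 * (+ 2 * j + + 1) ≡ (+ 2 * j + + 1) * + 16 + (+ 2 * b + + 1)
        coord₁ = solve-∀
        coord₂ : ∀ b j → + 2 * (b + j + + 1) - (+ 2 * j + + 1) ≡ + 2 * b + + 1
        coord₂ = solve-∀

  P3 P3h : Pred (ℤ × ℤ) 0ℓ
  P3 = OddRep 4 60 N
  P3h = OddSumRep 4 60 N
  P3? : Decidable P3
  P3? = OddRep? 4 60 N
  P3h? : Decidable P3h
  P3h? = OddSumRep? 4 60 N

  f3 : ℤ × ℤ → ℤ × ℤ
  f3 p = proj₁ p + + 15 * proj₂ p + + 8 , proj₁ p - proj₂ p

  P3-in-box : ∀ {p} → P3 p → InBox N p
  P3-in-box {p} = odd-in-box 3 59 N {proj₁ p} {proj₂ p}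

  f3-form : ∀ x y → + 1 * ((x + + 15 * y + + 8) * (x + + 15 * y + + 8)) + + 15 * ((x - y) * (x - y)) ≡ + 4 * ((+ 2 * x + + 1) * (+ 2 * x + + 1)) + + 60 * ((+ 2 * y + + 1) * (+ 2 * y + + 1))
  f3-form = solve-∀

  -- f3 maps the odd half of term 3 into the class: X - Y = 8(2y+1), and x + y = 2w + 1 makes X, Y odd.
  f3-into : ∀ {p} → P3h p → C1c (f3 p)
  f3-into {x , y} (e , hx) with not-even-odd (x + y) hx
  ... | w , ew = ((subst Odd (sym odd-X) (Odd-odd (w + + 7 * y + + 4)) , subst Odd (sym odd-Y) (Odd-odd (w - y)) , trans (f3-form x y) e) ,
                   divides (odd y) (trans (difference x y) (l8 y))) , not-double-divides 8 y _ (difference x y)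
    where
    x-eq : x ≡ odd w - y
    x-eq = trans (l x y) (cong (_- y) ew)
      where
      l : ∀ x y → x ≡ (x + y) - y
      l = solve-∀
    odd-X : x + + 15 * y + + 8 ≡ odd (w + + 7 * y + + 4)
    odd-X = trans (cong (λ t → t + + 15 * y + + 8) x-eq) (l w y)
      where
      l : ∀ w y → ((+ 2 * w + + 1) - y) + + 15 * y + + 8 ≡ + 2 * (w + + 7 * y + + 4) + + 1
      l = solve-∀
    odd-Y : x - y ≡ odd (w - y)
    odd-Y = trans (cong (_- y) x-eq) (l w y)
      where
      l : ∀ w y → ((+ 2 * w + + 1) - y) - y ≡ + 2 * (w - y) + + 1
      l = solve-∀
    l8 : ∀ y → + 8 * (+ 2 * y + + 1) ≡ (+ 2 * y + + 1) * + 8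
    l8 = solve-∀
    difference : ∀ x y → (x + + 15 * y + + 8) - (x - y) ≡ + 8 * (+ 2 * y + + 1)
    difference = solve-∀

  -- Every point of the class is hit: X - Y = 8q with q odd since 16 ∤ X - Y.
  f3-onto : ∀ {y} → C1c y → ∃ λ x → P3h x × f3 x ≡ y
  f3-onto {X , Y} (((ox , oy , e) , divides q eq) , n16) with Odd⇒odd {Y} oy | parity q
  ... | b , refl | inj₁ (j , refl) = ⊥-elim (n16 (even-quotient 8 j eq))
  ... | b , refl | inj₂ (j , refl) = (odd b + j , j) , (trans (sym (f3-form (odd b + j) j)) (trans (cong (λ p → form 1 15 (proj₁ p) (proj₂ p)) hits) e) ,
                                       odd-not-even (b + j) (sym (l3 b j))) , hits
    where
    hits : f3 (odd b + j , j) ≡ (X , odd b)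
    hits = cong₂ _,_ (trans (coord₁ b j) (sym (solve-sub X (odd b) (odd j * + 8) eq))) (coord₂ b j)
      where
      coord₁ : ∀ b j → (+ 2 * b + + 1) + j + + 15 * j + + 8 ≡ (+ 2 * j + + 1) * + 8 + (+ 2 * b + + 1)
      coord₁ = solve-∀
      coord₂ : ∀ b j → ((+ 2 * b + + 1) + j) - j ≡ + 2 * b + + 1
      coord₂ = solve-∀
    l3 : ∀ b j → + 2 * (b + j) + + 1 ≡ ((+ 2 * b + + 1) + j) + j
    l3 = solve-∀

  -- (x, y) ↦ (x + 15y + 8, x - y) matches the odd half of term 3 with X ≡ Y (mod 8)
  -- but not (mod 16), as X - Y = 8(2y+1).
  P3h→C1c : count N P3h? ≡ count N C1c?
  P3h→C1c = count-bijection N P3h? C1c? f3 (λ {p} c → P3-in-box {p} (proj₁ c))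
    (λ {p} c → OddSol-in-box {p} (proj₁ (proj₁ c)))
    (λ {p} → f3-into {p}) (injective-by-scaled-inverse (+ 16) f3 (λ p → proj₁ p + + 15 * proj₂ p - + 8 , proj₁ p - proj₂ p - + 8) (λ x y → cong₂ _,_ (undo₁ x y) (undo₂ x y))) (λ {y} → f3-onto {y})
    where
    undo₁ : ∀ x y → (x + + 15 * y + + 8) + + 15 * (x - y) - + 8 ≡ + 16 * x
    undo₁ = solve-∀
    undo₂ : ∀ x y → (x + + 15 * y + + 8) - (x - y) - + 8 ≡ + 16 * y
    undo₂ = solve-∀

  P4 : Pred (ℤ × ℤ) 0ℓ
  P4 = MixedRep 160 24 N
  P4? : Decidable P4
  P4? = MixedRep? 160 24 N

  f4 : ℤ × ℤ → ℤ × ℤ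
  f4 p = + 3 * odd (proj₂ p) + + 10 * proj₁ p , odd (proj₂ p) - + 2 * proj₁ p

  -- (m, Z) ↦ (3Z + 10m, Z - 2m) matches term 4 with X ≡ 3Y (mod 16), as X - 3Y = 16m.
  P4→C3a : count N P4? ≡ count N C3a?
  P4→C3a = count-bijection N P4? C3a? f4 (λ {p} → mixed-in-box 159 23 N {proj₁ p} {proj₂ p})
    (λ {p} c → OddSol-in-box {p} (proj₁ (proj₁ (proj₁ (proj₁ c)))))
    (λ {p} → into {p}) (injective-by-scaled-inverse (+ 16) f4 (λ p → proj₁ p - + 3 * proj₂ p , proj₁ p + + 5 * proj₂ p - + 8) (λ m z → cong₂ _,_ (undo₁ m z) (undo₂ m z))) (λ {y} → onto {y})
    where
    form-identity : ∀ m Z → + 1 * ((+ 3 * Z + + 10 * m) * (+ 3 * Z + + 10 * m)) + + 15 * ((Z - + 2 * m) * (Z - + 2 * m)) ≡ + 160 * (m * m) + + 24 * (Z * Z)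
    form-identity = solve-∀
    undo₁ : ∀ m z → (+ 3 * (+ 2 * z + + 1) + + 10 * m) - + 3 * ((+ 2 * z + + 1) - + 2 * m) ≡ + 16 * m
    undo₁ = solve-∀
    undo₂ : ∀ m z → (+ 3 * (+ 2 * z + + 1) + + 10 * m) + + 5 * ((+ 2 * z + + 1) - + 2 * m) - + 8 ≡ + 16 * z
    undo₂ = solve-∀
    odd-X : ∀ m z → + 2 * (+ 3 * z + + 5 * m + + 1) + + 1 ≡ + 3 * (+ 2 * z + + 1) + + 10 * m
    odd-X = solve-∀
    odd-Y : ∀ m z → + 2 * (z - m) + + 1 ≡ (+ 2 * z + + 1) - + 2 * m
    odd-Y = solve-∀
    d1 : ∀ m z → (+ 3 * (+ 2 * z + + 1) + + 10 * m) - ((+ 2 * z + + 1) - + 2 * m) ≡ + 2 * (+ 2 * (z + + 3 * m) + + 1)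
    d1 = solve-∀
    d2 : ∀ m z → (+ 3 * (+ 2 * z + + 1) + + 10 * m) + ((+ 2 * z + + 1) - + 2 * m) ≡ + 4 * (+ 2 * (z + m) + + 1)
    d2 = solve-∀
    d3 : ∀ m z → (+ 3 * (+ 2 * z + + 1) + + 10 * m) - + 3 * ((+ 2 * z + + 1) - + 2 * m) ≡ (+ 2 * m) * + 8
    d3 = solve-∀
    d4 : ∀ m z → (+ 3 * (+ 2 * z + + 1) + + 10 * m) - + 3 * ((+ 2 * z + + 1) - + 2 * m) ≡ m * + 16
    d4 = solve-∀
    into : ∀ {p} → P4 p → C3a (f4 p)
    into {m , z} e = ((((subst Odd (odd-X m z) (Odd-odd (+ 3 * z + + 5 * m + + 1)) , subst Odd (odd-Y m z) (Odd-odd (z - m)) , trans (form-identity m (odd z)) e) ,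
                      not-multiple-double-divides 2 2 (z + + 3 * m) _ (d1 m z)) , not-double-divides 4 (z + m) _ (d2 m z)) , divides (+ 2 * m) (d3 m z)) , divides m (d4 m z)
    onto : ∀ {y} → C3a y → ∃ λ x → P4 x × f4 x ≡ y
    onto {X , Y} (((((ox , oy , e) , _) , _) , _) , divides q eq) with Odd⇒odd {Y} oy
    ... | b , refl = (q , b + q) , trans (sym (form-identity q (odd (b + q)))) (trans (cong (λ p → form 1 15 (proj₁ p) (proj₂ p)) hits) e) , hits
      where
      hits : f4 (q , b + q) ≡ (X , odd b)
      hits = cong₂ _,_ (trans (coord₁ q b) (sym (solve-sub X (+ 3 * odd b) (q * + 16) eq))) (coord₂ q b)
        where
        coord₁ : ∀ q b → + 3 * (+ 2 * (b + q) + + 1) + + 10 * q ≡ q * + 16 + + 3 * (+ 2 * b + + 1)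
        coord₁ = solve-∀
        coord₂ : ∀ q b → (+ 2 * (b + q) + + 1) - + 2 * q ≡ + 2 * b + + 1
        coord₂ = solve-∀

  P5 : Pred (ℤ × ℤ) 0ℓ
  P5 = MixedRep 96 40 N
  P5? : Decidable P5
  P5? = MixedRep? 96 40 N

  f5 : ℤ × ℤ → ℤ × ℤ
  f5 p = + 6 * proj₁ p + + 5 * odd (proj₂ p) , + 2 * proj₁ p - odd (proj₂ p)

  -- (m, Z) ↦ (6m + 5Z, 2m - Z) matches term 5 with X ≡ 3Y (mod 8) but not (mod 16), as X - 3Y = 8Z.
  P5→C3b : count N P5? ≡ count N C3b?
  P5→C3b = count-bijection N P5? C3b? f5 (λ {p} → mixed-in-box 95 39 N {proj₁ p} {proj₂ p})
    (λ {p} c → OddSol-in-box {p} (proj₁ (proj₁ (proj₁ (proj₁ c)))))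
    (λ {p} → into {p}) (injective-by-scaled-inverse (+ 16) f5 (λ p → proj₁ p + + 5 * proj₂ p , proj₁ p - + 3 * proj₂ p - + 8) (λ m z → cong₂ _,_ (undo₁ m z) (undo₂ m z))) (λ {y} → onto {y})
    where
    form-identity : ∀ m Z → + 1 * ((+ 6 * m + + 5 * Z) * (+ 6 * m + + 5 * Z)) + + 15 * ((+ 2 * m - Z) * (+ 2 * m - Z)) ≡ + 96 * (m * m) + + 40 * (Z * Z)
    form-identity = solve-∀
    undo₁ : ∀ m z → (+ 6 * m + + 5 * (+ 2 * z + + 1)) + + 5 * (+ 2 * m - (+ 2 * z + + 1)) ≡ + 16 * m
    undo₁ = solve-∀
    undo₂ : ∀ m z → (+ 6 * m + + 5 * (+ 2 * z + + 1)) - + 3 * (+ 2 * m - (+ 2 * z + + 1)) - + 8 ≡ + 16 * z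
    undo₂ = solve-∀
    odd-X : ∀ m z → + 2 * (+ 3 * m + + 5 * z + + 2) + + 1 ≡ + 6 * m + + 5 * (+ 2 * z + + 1)
    odd-X = solve-∀
    odd-Y : ∀ m z → + 2 * (m - z - + 1) + + 1 ≡ + 2 * m - (+ 2 * z + + 1)
    odd-Y = solve-∀
    d1 : ∀ m z → (+ 6 * m + + 5 * (+ 2 * z + + 1)) - (+ 2 * m - (+ 2 * z + + 1)) ≡ + 2 * (+ 2 * (m + + 3 * z + + 1) + + 1)
    d1 = solve-∀
    d2 : ∀ m z → (+ 6 * m + + 5 * (+ 2 * z + + 1)) + (+ 2 * m - (+ 2 * z + + 1)) ≡ + 4 * (+ 2 * (m + z) + + 1)
    d2 = solve-∀
    d3 : ∀ m z → (+ 6 * m + + 5 * (+ 2 * z + + 1)) - + 3 * (+ 2 * m - (+ 2 * z + + 1)) ≡ + 8 * (+ 2 * z + + 1)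
    d3 = solve-∀
    d3' : ∀ Z → + 8 * Z ≡ Z * + 8
    d3' = solve-∀
    into : ∀ {p} → P5 p → C3b (f5 p)
    into {m , z} e = ((((subst Odd (odd-X m z) (Odd-odd (+ 3 * m + + 5 * z + + 2)) , subst Odd (odd-Y m z) (Odd-odd (m - z - + 1)) , trans (form-identity m (odd z)) e) ,
                      not-multiple-double-divides 2 2 (m + + 3 * z + + 1) _ (d1 m z)) , not-double-divides 4 (m + z) _ (d2 m z)) , divides (odd z) (trans (d3 m z) (d3' (odd z)))) , not-double-divides 8 z _ (d3 m z)
    onto : ∀ {y} → C3b y → ∃ λ x → P5 x × f5 x ≡ y
    onto {X , Y} (((((ox , oy , e) , _) , _) , divides q eq) , n16) with Odd⇒odd {Y} oy | parity q
    ... | b , refl | inj₁ (j , refl) = ⊥-elim (n16 (even-quotient 8 j eq))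
    ... | b , refl | inj₂ (j , refl) = (b + j + + 1 , j) , trans (sym (form-identity (b + j + + 1) (odd j))) (trans (cong (λ p → form 1 15 (proj₁ p) (proj₂ p)) hits) e) , hits
      where
      hits : f5 (b + j + + 1 , j) ≡ (X , odd b)
      hits = cong₂ _,_ (trans (coord₁ b j) (sym (solve-sub X (+ 3 * odd b) (odd j * + 8) eq))) (coord₂ b j)
        where
        coord₁ : ∀ b j → + 6 * (b + j + + 1) + + 5 * (+ 2 * j + + 1) ≡ (+ 2 * j + + 1) * + 8 + + 3 * (+ 2 * b + + 1)
        coord₁ = solve-∀
        coord₂ : ∀ b j → + 2 * (b + j + + 1) - (+ 2 * j + + 1) ≡ + 2 * b + + 1
        coord₂ = solve-∀

  class-X≡Y : count N C1? ≡ count N P1? ℕ.+ count N P2? ℕ.+ count N P3h?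
  class-X≡Y = begin
      count N C1?                                  ≡⟨ filter-length-split C1? B16? (box N) ⟩
      count N C1ab? ℕ.+ count N C1c?                ≡⟨ cong (ℕ._+ count N C1c?) (filter-length-split C1ab? B32? (box N)) ⟩
      count N C1a? ℕ.+ count N C1b? ℕ.+ count N C1c? ≡⟨ cong₂ (λ s t → s ℕ.+ t ℕ.+ count N C1c?) P1→C1a P2→C1b ⟨
      count N P1? ℕ.+ count N P2? ℕ.+ count N C1c?   ≡⟨ cong (count N P1? ℕ.+ count N P2? ℕ.+_) P3h→C1c ⟨
      count N P1? ℕ.+ count N P2? ℕ.+ count N P3h?   ∎
    where open ≡-Reasoning

  class-X≡3Y : count N C3? ≡ count N P4? ℕ.+ count N P5?
  class-X≡3Y = begin
      count N C3?                     ≡⟨ filter-length-split C3? E16? (box N) ⟩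
      count N C3a? ℕ.+ count N C3b?   ≡⟨ cong₂ ℕ._+_ P4→C3a P5→C3b ⟨
      count N P4? ℕ.+ count N P5?     ∎
    where open ≡-Reasoning

  P3-halves : count N P3? ≡ 2 ℕ.* count N P3h?
  P3-halves = begin
      count N P3?                     ≡⟨ sum-parity-split 4 60 N ⟩
      count N P3e? ℕ.+ count N P3h?   ≡⟨ cong (ℕ._+ count N P3h?) (even-sum≡odd-sum 3 59 N) ⟩
      count N P3h? ℕ.+ count N P3h?   ≡⟨ cong (count N P3h? ℕ.+_) (NP.+-identityʳ (count N P3h?)) ⟨
      2 ℕ.* count N P3h?              ∎
    where
    open ≡-Reasoning
    P3e? : Decidable (EvenSumRep 4 60 N)
    P3e? = EvenSumRep? 4 60 N

  second-reduction : count N (OddRep? 1 15 N) ≡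
    2 ℕ.* count N (MixedRep? 960 16 N) ℕ.+ 2 ℕ.* count N (MixedRep? 64 240 N) ℕ.+ count N (OddRep? 4 60 N)
      ℕ.+ 2 ℕ.* count N (MixedRep? 160 24 N) ℕ.+ 2 ℕ.* count N (MixedRep? 96 40 N)
  second-reduction = begin
      count N OddParam?                                       ≡⟨ split-count ⟩
      2 ℕ.* count N C1? ℕ.+ 2 ℕ.* count N C3?                 ≡⟨ cong₂ (λ s t → 2 ℕ.* s ℕ.+ 2 ℕ.* t) class-X≡Y class-X≡3Y ⟩
      2 ℕ.* (p₁ ℕ.+ p₂ ℕ.+ h) ℕ.+ 2 ℕ.* (p₄ ℕ.+ p₅)            ≡⟨ rearrange p₁ p₂ h p₄ p₅ ⟩
      2 ℕ.* p₁ ℕ.+ 2 ℕ.* p₂ ℕ.+ 2 ℕ.* h ℕ.+ 2 ℕ.* p₄ ℕ.+ 2 ℕ.* p₅ ≡⟨ cong (λ t → 2 ℕ.* p₁ ℕ.+ 2 ℕ.* p₂ ℕ.+ t ℕ.+ 2 ℕ.* p₄ ℕ.+ 2 ℕ.* p₅) P3-halves ⟨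
      2 ℕ.* p₁ ℕ.+ 2 ℕ.* p₂ ℕ.+ count N P3? ℕ.+ 2 ℕ.* p₄ ℕ.+ 2 ℕ.* p₅ ∎
    where
    open ≡-Reasoning
    p₁ p₂ h p₄ p₅ : ℕ
    p₁ = count N P1?
    p₂ = count N P2?
    h = count N P3h?
    p₄ = count N P4?
    p₅ = count N P5?
    rearrange : ∀ a b c d e → 2 ℕ.* (a ℕ.+ b ℕ.+ c) ℕ.+ 2 ℕ.* (d ℕ.+ e) ≡ 2 ℕ.* a ℕ.+ 2 ℕ.* b ℕ.+ 2 ℕ.* c ℕ.+ 2 ℕ.* d ℕ.+ 2 ℕ.* e
    rearrange = NT.solve-∀

module FirstReduction (N : ℕ) where

  -- Qi is the form belonging to the
  -- i-th term of the identity.  Each class of ResidueSplit 2 4 N is refined by a congruence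
  -- mod 16 or 32 and every refined class is matched with one Qi by an explicit linear map.

  open ListCounting
  open LatticeCounts
  open OddIntegers
  open Representations
  open import Data.Nat as ℕ using (ℕ)
  import Data.Nat.Properties as NP
  open import Data.Integer using (ℤ; +_; _+_; _*_; _-_)
  open import Data.Integer.Divisibility.Signed using (divides)
  open import Data.Integer.Tactic.RingSolver using (solve-∀)
  import Data.Nat.Tactic.RingSolver as NT
  open import Relation.Nullary
  open import Relation.Nullary.Decidable using (_×-dec_; ¬?)
  open import Relation.Unary using (Pred; Decidable)
  open import Relation.Binary.PropositionalEquality
  open import Data.Product using (_×_; _,_; ∃; proj₁; proj₂)
  open import Data.Sum using (inj₁; inj₂)
  open import Data.Empty using (⊥-elim)
  open import Level using (0ℓ)

  open ResidueSplit 2 4 N public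

  B16 F16 F32 : Pred (ℤ × ℤ) 0ℓ
  B16 p = Div 16 (proj₁ p - proj₂ p)
  F16 p = Div 16 (proj₁ p + + 5 * proj₂ p)
  F32 p = Div 32 (proj₁ p + + 5 * proj₂ p)
  B16? : Decidable B16
  B16? p = Div? 16 (proj₁ p - proj₂ p)
  F16? : Decidable F16
  F16? p = Div? 16 (proj₁ p + + 5 * proj₂ p)
  F32? : Decidable F32
  F32? p = Div? 32 (proj₁ p + + 5 * proj₂ p)

  C1ab C1c C3c C3f C3x C3y : Pred (ℤ × ℤ) 0ℓ
  C1ab p = C1 p × B16 p
  C1c p = C1 p × ¬ B16 p
  C3f p = C3 p × F16 p
  C3c p = C3 p × ¬ F16 p
  C3x p = C3f p × F32 p
  C3y p = C3f p × ¬ F32 p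
  C1ab? : Decidable C1ab
  C1ab? p = C1? p ×-dec B16? p
  C1c? : Decidable C1c
  C1c? p = C1? p ×-dec ¬? (B16? p)
  C3f? : Decidable C3f
  C3f? p = C3? p ×-dec F16? p
  C3c? : Decidable C3c
  C3c? p = C3? p ×-dec ¬? (F16? p)
  C3x? : Decidable C3x
  C3x? p = C3f? p ×-dec F32? p
  C3y? : Decidable C3y
  C3y? p = C3f? p ×-dec ¬? (F32? p)

  Q1 : Pred (ℤ × ℤ) 0ℓ
  Q1 = MixedRep 480 8 N
  Q1? : Decidable Q1
  Q1? = MixedRep? 480 8 N

  f1 : ℤ × ℤ → ℤ × ℤ
  f1 p = odd (proj₂ p) + + 10 * proj₁ p , odd (proj₂ p) - + 6 * proj₁ p

  -- (m, Z) ↦ (Z + 10m, Z - 6m) matches term 1 with X ≡ Y (mod 16), as X - Y = 16m.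
  Q1→C1ab : count N Q1? ≡ count N C1ab?
  Q1→C1ab = count-bijection N Q1? C1ab? f1 (λ {p} → mixed-in-box 479 7 N {proj₁ p} {proj₂ p})
    (λ {p} c → OddSol-in-box {p} (proj₁ (proj₁ c)))
    (λ {p} → into {p}) (injective-by-scaled-inverse (+ 16) f1 (λ p → proj₁ p - proj₂ p , + 3 * proj₁ p + + 5 * proj₂ p - + 8) (λ m z → cong₂ _,_ (undo₁ m z) (undo₂ m z))) (λ {y} → onto {y})
    where
    form-identity : ∀ m Z → + 3 * ((Z + + 10 * m) * (Z + + 10 * m)) + + 5 * ((Z - + 6 * m) * (Z - + 6 * m)) ≡ + 480 * (m * m) + + 8 * (Z * Z)
    form-identity = solve-∀
    undo₁ : ∀ m z → ((+ 2 * z + + 1) + + 10 * m) - ((+ 2 * z + + 1) - + 6 * m) ≡ + 16 * m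
    undo₁ = solve-∀
    undo₂ : ∀ m z → + 3 * ((+ 2 * z + + 1) + + 10 * m) + + 5 * ((+ 2 * z + + 1) - + 6 * m) - + 8 ≡ + 16 * z
    undo₂ = solve-∀
    odd-X : ∀ m z → + 2 * (z + + 5 * m) + + 1 ≡ (+ 2 * z + + 1) + + 10 * m
    odd-X = solve-∀
    odd-Y : ∀ m z → + 2 * (z - + 3 * m) + + 1 ≡ (+ 2 * z + + 1) - + 6 * m
    odd-Y = solve-∀
    d8 : ∀ m z → ((+ 2 * z + + 1) + + 10 * m) - ((+ 2 * z + + 1) - + 6 * m) ≡ (+ 2 * m) * + 8
    d8 = solve-∀
    d16 : ∀ m z → ((+ 2 * z + + 1) + + 10 * m) - ((+ 2 * z + + 1) - + 6 * m) ≡ m * + 16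
    d16 = solve-∀
    into : ∀ {p} → Q1 p → C1ab (f1 p)
    into {m , z} e = ((subst Odd (odd-X m z) (Odd-odd (z + + 5 * m)) , subst Odd (odd-Y m z) (Odd-odd (z - + 3 * m)) , trans (form-identity m (odd z)) e) ,
                      divides (+ 2 * m) (d8 m z)) , divides m (d16 m z)
    onto : ∀ {y} → C1ab y → ∃ λ x → Q1 x × f1 x ≡ y
    onto {X , Y} (((ox , oy , e) , _) , divides q eq) with Odd⇒odd {Y} oy
    ... | b , refl = (q , b + + 3 * q) , trans (sym (form-identity q (odd (b + + 3 * q)))) (trans (cong (λ p → form 3 5 (proj₁ p) (proj₂ p)) hits) e) , hits
      where
      hits : f1 (q , b + + 3 * q) ≡ (X , odd b)
      hits = cong₂ _,_ (trans (coord₁ q b) (sym (solve-sub X (odd b) (q * + 16) eq))) (coord₂ q b)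
        where
        coord₁ : ∀ q b → (+ 2 * (b + + 3 * q) + + 1) + + 10 * q ≡ q * + 16 + (+ 2 * b + + 1)
        coord₁ = solve-∀
        coord₂ : ∀ q b → (+ 2 * (b + + 3 * q) + + 1) - + 6 * q ≡ + 2 * b + + 1
        coord₂ = solve-∀

  Q2 : Pred (ℤ × ℤ) 0ℓ
  Q2 = MixedRep 32 120 N
  Q2? : Decidable Q2
  Q2? = MixedRep? 32 120 N

  f2 : ℤ × ℤ → ℤ × ℤ
  f2 p = + 2 * proj₁ p + + 5 * odd (proj₂ p) , + 2 * proj₁ p - + 3 * odd (proj₂ p)

  -- (m, Z) ↦ (2m + 5Z, 2m - 3Z) matches term 2 with X ≡ Y (mod 8) but not (mod 16), as X - Y = 8Z.
  Q2→C1c : count N Q2? ≡ count N C1c?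
  Q2→C1c = count-bijection N Q2? C1c? f2 (λ {p} → mixed-in-box 31 119 N {proj₁ p} {proj₂ p})
    (λ {p} c → OddSol-in-box {p} (proj₁ (proj₁ c)))
    (λ {p} → into {p}) (injective-by-scaled-inverse (+ 16) f2 (λ p → + 3 * proj₁ p + + 5 * proj₂ p , proj₁ p - proj₂ p - + 8) (λ m z → cong₂ _,_ (undo₁ m z) (undo₂ m z))) (λ {y} → onto {y})
    where
    form-identity : ∀ m Z → + 3 * ((+ 2 * m + + 5 * Z) * (+ 2 * m + + 5 * Z)) + + 5 * ((+ 2 * m - + 3 * Z) * (+ 2 * m - + 3 * Z)) ≡ + 32 * (m * m) + + 120 * (Z * Z)
    form-identity = solve-∀
    undo₁ : ∀ m z → + 3 * (+ 2 * m + + 5 * (+ 2 * z + + 1)) + + 5 * (+ 2 * m - + 3 * (+ 2 * z + + 1)) ≡ + 16 * m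
    undo₁ = solve-∀
    undo₂ : ∀ m z → (+ 2 * m + + 5 * (+ 2 * z + + 1)) - (+ 2 * m - + 3 * (+ 2 * z + + 1)) - + 8 ≡ + 16 * z
    undo₂ = solve-∀
    odd-X : ∀ m z → + 2 * (m + + 5 * z + + 2) + + 1 ≡ + 2 * m + + 5 * (+ 2 * z + + 1)
    odd-X = solve-∀
    odd-Y : ∀ m z → + 2 * (m - + 3 * z - + 2) + + 1 ≡ + 2 * m - + 3 * (+ 2 * z + + 1)
    odd-Y = solve-∀
    difference : ∀ m Z → (+ 2 * m + + 5 * Z) - (+ 2 * m - + 3 * Z) ≡ + 8 * Z
    difference = solve-∀
    l8 : ∀ Z → + 8 * Z ≡ Z * + 8
    l8 = solve-∀
    into : ∀ {p} → Q2 p → C1c (f2 p)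
    into {m , z} e = ((subst Odd (odd-X m z) (Odd-odd (m + + 5 * z + + 2)) , subst Odd (odd-Y m z) (Odd-odd (m - + 3 * z - + 2)) , trans (form-identity m (odd z)) e) ,
                      divides (odd z) (trans (difference m (odd z)) (l8 (odd z)))) , not-double-divides 8 z _ (difference m (odd z))
    onto : ∀ {y} → C1c y → ∃ λ x → Q2 x × f2 x ≡ y
    onto {X , Y} (((ox , oy , e) , divides q eq) , n16) with Odd⇒odd {Y} oy | parity q
    ... | b , refl | inj₁ (j , refl) = ⊥-elim (n16 (even-quotient 8 j eq))
    ... | b , refl | inj₂ (j , refl) = (b + + 3 * j + + 2 , j) , trans (sym (form-identity (b + + 3 * j + + 2) (odd j))) (trans (cong (λ p → form 3 5 (proj₁ p) (proj₂ p)) hits) e) , hits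
      where
      hits : f2 (b + + 3 * j + + 2 , j) ≡ (X , odd b)
      hits = cong₂ _,_ (trans (coord₁ b j) (sym (solve-sub X (odd b) (odd j * + 8) eq))) (coord₂ b j)
        where
        coord₁ : ∀ b j → + 2 * (b + + 3 * j + + 2) + + 5 * (+ 2 * j + + 1) ≡ (+ 2 * j + + 1) * + 8 + (+ 2 * b + + 1)
        coord₁ = solve-∀
        coord₂ : ∀ b j → + 2 * (b + + 3 * j + + 2) - + 3 * (+ 2 * j + + 1) ≡ + 2 * b + + 1
        coord₂ = solve-∀

  Q3 Q3h : Pred (ℤ × ℤ) 0ℓ
  Q3 = OddRep 12 20 N
  Q3h = EvenSumRep 12 20 N
  Q3? : Decidable Q3
  Q3? = OddRep? 12 20 N
  Q3h? : Decidable Q3h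
  Q3h? = EvenSumRep? 12 20 N

  f3 : ℤ × ℤ → ℤ × ℤ
  f3 p = proj₁ p + + 5 * proj₂ p + + 3 , + 3 * proj₁ p - proj₂ p + + 1

  Q3-in-box : ∀ {p} → Q3 p → InBox N p
  Q3-in-box {p} = odd-in-box 11 19 N {proj₁ p} {proj₂ p}

  f3-form : ∀ x y → + 3 * ((x + + 5 * y + + 3) * (x + + 5 * y + + 3)) + + 5 * ((+ 3 * x - y + + 1) * (+ 3 * x - y + + 1)) ≡ + 12 * ((+ 2 * x + + 1) * (+ 2 * x + + 1)) + + 20 * ((+ 2 * y + + 1) * (+ 2 * y + + 1))
  f3-form = solve-∀

  -- f3 maps the even half of term 3 into the class: writing x + y = 2w, the residue conditions
  -- are read off from X - Y = 2(2(2y-w)+1), X + Y = 4(2w+1), X - 3Y = 8(y-x), X + 5Y = 8(2x+1).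
  f3-into : ∀ {p} → Q3h p → C3c (f3 p)
  f3-into {x , y} (e , divides w ew) =
    ((((subst Odd (sym odd-X) (Odd-odd (w + + 2 * y + + 1)) , subst Odd (sym odd-Y) (Odd-odd (+ 3 * w - + 2 * y)) , trans (f3-form x y) e) ,
      not-multiple-double-divides 2 2 (+ 2 * y - w) _ dA1) , not-double-divides 4 w _ dA2) , divides (y - x) (dA3 x y)) , not-double-divides 8 x _ (dF x y)
    where
    x-eq : x ≡ w * + 2 - y
    x-eq = trans (l x y) (cong (_- y) ew)
      where
      l : ∀ x y → x ≡ (x + y) - y
      l = solve-∀
    odd-X : x + + 5 * y + + 3 ≡ odd (w + + 2 * y + + 1)
    odd-X = trans (cong (λ t → t + + 5 * y + + 3) x-eq) (l w y)
      where
      l : ∀ w y → (w * + 2 - y) + + 5 * y + + 3 ≡ + 2 * (w + + 2 * y + + 1) + + 1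
      l = solve-∀
    odd-Y : + 3 * x - y + + 1 ≡ odd (+ 3 * w - + 2 * y)
    odd-Y = trans (cong (λ t → + 3 * t - y + + 1) x-eq) (l w y)
      where
      l : ∀ w y → + 3 * (w * + 2 - y) - y + + 1 ≡ + 2 * (+ 3 * w - + 2 * y) + + 1
      l = solve-∀
    dA1 : (x + + 5 * y + + 3) - (+ 3 * x - y + + 1) ≡ + 2 * odd (+ 2 * y - w)
    dA1 = trans (cong (λ t → (t + + 5 * y + + 3) - (+ 3 * t - y + + 1)) x-eq) (l w y)
      where
      l : ∀ w y → ((w * + 2 - y) + + 5 * y + + 3) - (+ 3 * (w * + 2 - y) - y + + 1) ≡ + 2 * (+ 2 * (+ 2 * y - w) + + 1)
      l = solve-∀
    dA2 : (x + + 5 * y + + 3) + (+ 3 * x - y + + 1) ≡ + 4 * odd w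
    dA2 = trans (l x y) (trans (cong (λ t → + 4 * t + + 4) ew) (l2 w))
      where
      l : ∀ x y → (x + + 5 * y + + 3) + (+ 3 * x - y + + 1) ≡ + 4 * (x + y) + + 4
      l = solve-∀
      l2 : ∀ w → + 4 * (w * + 2) + + 4 ≡ + 4 * (+ 2 * w + + 1)
      l2 = solve-∀
    dA3 : ∀ x y → (x + + 5 * y + + 3) - + 3 * (+ 3 * x - y + + 1) ≡ (y - x) * + 8
    dA3 = solve-∀
    dF : ∀ x y → (x + + 5 * y + + 3) + + 5 * (+ 3 * x - y + + 1) ≡ + 8 * (+ 2 * x + + 1)
    dF = solve-∀

  -- Every point of the class is hit: from X - 3Y = 8v with v + Y odd one solves for (x, y).
  f3-onto : ∀ {y} → C3c y → ∃ λ x → Q3h x × f3 x ≡ y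
  f3-onto {X , Y} (((((ox , oy , e) , _) , _) , divides v a3) , n16) with Odd⇒odd {Y} oy
  ... | b , refl with parity (v + odd b)
  ... | inj₁ (j , ej) = ⊥-elim (n16 (divides j (trans (l X (odd b)) (trans (cong (λ t → t + + 8 * odd b) a3) (trans (l2 v (odd b)) (trans (cong (_* + 8) ej) (l3 j)))))))
    where
    l : ∀ X Y → X + + 5 * Y ≡ (X - + 3 * Y) + + 8 * Y
    l = solve-∀
    l2 : ∀ v Y → v * + 8 + + 8 * Y ≡ (v + Y) * + 8
    l2 = solve-∀
    l3 : ∀ j → (+ 2 * j) * + 8 ≡ j * + 16
    l3 = solve-∀
  ... | inj₂ (j , ej) = (j , + 3 * j - + 2 * b) , (trans (sym (f3-form j (+ 3 * j - + 2 * b))) (trans (cong (λ p → form 3 5 (proj₁ p) (proj₂ p)) hits) e) ,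
                          divides (+ 2 * j - b) (l4 j b)) , hits
    where
    v-eq : v ≡ odd j - odd b
    v-eq = trans (solve-add v (odd b) (odd j) ej) refl
    X-eq : X ≡ (odd j - odd b) * + 8 + + 3 * odd b
    X-eq = trans (solve-sub X (+ 3 * odd b) (v * + 8) a3) (cong (λ t → t * + 8 + + 3 * odd b) v-eq)
    hits : f3 (j , + 3 * j - + 2 * b) ≡ (X , odd b)
    hits = cong₂ _,_ (trans (coord₁ j b) (sym X-eq)) (coord₂ j b)
      where
      coord₁ : ∀ j b → j + + 5 * (+ 3 * j - + 2 * b) + + 3 ≡ ((+ 2 * j + + 1) - (+ 2 * b + + 1)) * + 8 + + 3 * (+ 2 * b + + 1)
      coord₁ = solve-∀
      coord₂ : ∀ j b → + 3 * j - (+ 3 * j - + 2 * b) + + 1 ≡ + 2 * b + + 1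
      coord₂ = solve-∀
    l4 : ∀ j b → j + (+ 3 * j - + 2 * b) ≡ (+ 2 * j - b) * + 2
    l4 = solve-∀

  -- (x, y) ↦ (x + 5y + 3, 3x - y + 1) matches the even half of term 3 with
  -- X ≡ 3Y (mod 8) and X + 5Y ≢ 0 (mod 16), as X + 5Y = 8(2x+1).
  Q3h→C3c : count N Q3h? ≡ count N C3c?
  Q3h→C3c = count-bijection N Q3h? C3c? f3 (λ {p} c → Q3-in-box {p} (proj₁ c))
    (λ {p} c → OddSol-in-box {p} (proj₁ (proj₁ (proj₁ (proj₁ c)))))
    (λ {p} → f3-into {p}) (injective-by-scaled-inverse (+ 16) f3 (λ p → proj₁ p + + 5 * proj₂ p - + 8 , + 3 * proj₁ p - proj₂ p - + 8) (λ x y → cong₂ _,_ (undo₁ x y) (undo₂ x y))) (λ {y} → f3-onto {y})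
    where
    undo₁ : ∀ x y → (x + + 5 * y + + 3) + + 5 * (+ 3 * x - y + + 1) - + 8 ≡ + 16 * x
    undo₁ = solve-∀
    undo₂ : ∀ x y → + 3 * (x + + 5 * y + + 3) - (+ 3 * x - y + + 1) - + 8 ≡ + 16 * y
    undo₂ = solve-∀

  Q4 : Pred (ℤ × ℤ) 0ℓ
  Q4 = MixedRep 320 48 N
  Q4? : Decidable Q4
  Q4? = MixedRep? 320 48 N

  f4 : ℤ × ℤ → ℤ × ℤ
  f4 p = odd (proj₂ p) + + 10 * proj₁ p , + 3 * odd (proj₂ p) - + 2 * proj₁ p

  -- (m, Z) ↦ (Z + 10m, 3Z - 2m) matches term 4 with X + 5Y ≡ 16 (mod 32), as X + 5Y = 16Z.
  Q4→C3y : count N Q4? ≡ count N C3y?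
  Q4→C3y = count-bijection N Q4? C3y? f4 (λ {p} → mixed-in-box 319 47 N {proj₁ p} {proj₂ p})
    (λ {p} c → OddSol-in-box {p} (proj₁ (proj₁ (proj₁ (proj₁ (proj₁ c))))))
    (λ {p} → into {p}) (injective-by-scaled-inverse (+ 32) f4 (λ p → + 3 * proj₁ p - proj₂ p , proj₁ p + + 5 * proj₂ p - + 16) (λ m z → cong₂ _,_ (undo₁ m z) (undo₂ m z))) (λ {y} → onto {y})
    where
    form-identity : ∀ m Z → + 3 * ((Z + + 10 * m) * (Z + + 10 * m)) + + 5 * ((+ 3 * Z - + 2 * m) * (+ 3 * Z - + 2 * m)) ≡ + 320 * (m * m) + + 48 * (Z * Z)
    form-identity = solve-∀
    undo₁ : ∀ m z → + 3 * ((+ 2 * z + + 1) + + 10 * m) - (+ 3 * (+ 2 * z + + 1) - + 2 * m) ≡ + 32 * m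
    undo₁ = solve-∀
    undo₂ : ∀ m z → ((+ 2 * z + + 1) + + 10 * m) + + 5 * (+ 3 * (+ 2 * z + + 1) - + 2 * m) - + 16 ≡ + 32 * z
    undo₂ = solve-∀
    odd-X : ∀ m z → + 2 * (z + + 5 * m) + + 1 ≡ (+ 2 * z + + 1) + + 10 * m
    odd-X = solve-∀
    odd-Y : ∀ m z → + 2 * (+ 3 * z - m + + 1) + + 1 ≡ + 3 * (+ 2 * z + + 1) - + 2 * m
    odd-Y = solve-∀
    d1 : ∀ m z → ((+ 2 * z + + 1) + + 10 * m) - (+ 3 * (+ 2 * z + + 1) - + 2 * m) ≡ + 2 * (+ 2 * (+ 3 * m - z - + 1) + + 1)
    d1 = solve-∀
    d2 : ∀ m z → ((+ 2 * z + + 1) + + 10 * m) + (+ 3 * (+ 2 * z + + 1) - + 2 * m) ≡ + 4 * (+ 2 * (z + m) + + 1)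
    d2 = solve-∀
    d3 : ∀ m z → ((+ 2 * z + + 1) + + 10 * m) - + 3 * (+ 3 * (+ 2 * z + + 1) - + 2 * m) ≡ (+ 2 * m - (+ 2 * z + + 1)) * + 8
    d3 = solve-∀
    d4 : ∀ m z → ((+ 2 * z + + 1) + + 10 * m) + + 5 * (+ 3 * (+ 2 * z + + 1) - + 2 * m) ≡ + 16 * (+ 2 * z + + 1)
    d4 = solve-∀
    d4' : ∀ Z → + 16 * Z ≡ Z * + 16
    d4' = solve-∀
    into : ∀ {p} → Q4 p → C3y (f4 p)
    into {m , z} e = (((((subst Odd (odd-X m z) (Odd-odd (z + + 5 * m)) , subst Odd (odd-Y m z) (Odd-odd (+ 3 * z - m + + 1)) , trans (form-identity m (odd z)) e) ,
                      not-multiple-double-divides 2 2 (+ 3 * m - z - + 1) _ (d1 m z)) , not-double-divides 4 (z + m) _ (d2 m z)) , divides (+ 2 * m - odd z) (d3 m z)) ,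
                      divides (odd z) (trans (d4 m z) (d4' (odd z)))) , not-double-divides 16 z _ (d4 m z)
    onto : ∀ {y} → C3y y → ∃ λ x → Q4 x × f4 x ≡ y
    onto {X , Y} ((((((ox , oy , e) , _) , _) , _) , divides q eq) , n32) with Odd⇒odd {Y} oy | parity q
    ... | b , refl | inj₁ (j , refl) = ⊥-elim (n32 (even-quotient 16 j eq))
    ... | b , refl | inj₂ (j , refl) = (+ 3 * j - b + + 1 , j) , trans (sym (form-identity (+ 3 * j - b + + 1) (odd j))) (trans (cong (λ p → form 3 5 (proj₁ p) (proj₂ p)) hits) e) , hits
      where
      hits : f4 (+ 3 * j - b + + 1 , j) ≡ (X , odd b)
      hits = cong₂ _,_ (trans (coord₁ b j) (sym (solve-add X (+ 5 * odd b) (odd j * + 16) eq))) (coord₂ b j)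
        where
        coord₁ : ∀ b j → (+ 2 * j + + 1) + + 10 * (+ 3 * j - b + + 1) ≡ (+ 2 * j + + 1) * + 16 - + 5 * (+ 2 * b + + 1)
        coord₁ = solve-∀
        coord₂ : ∀ b j → + 3 * (+ 2 * j + + 1) - + 2 * (+ 3 * j - b + + 1) ≡ + 2 * b + + 1
        coord₂ = solve-∀

  Q5 : Pred (ℤ × ℤ) 0ℓ
  Q5 = MixedRep 192 80 N
  Q5? : Decidable Q5
  Q5? = MixedRep? 192 80 N

  f5 : ℤ × ℤ → ℤ × ℤ
  f5 p = + 2 * proj₁ p + + 5 * odd (proj₂ p) , + 6 * proj₁ p - odd (proj₂ p)

  -- (m, Z) ↦ (2m + 5Z, 6m - Z) matches term 5 with X + 5Y ≡ 0 (mod 32), as X + 5Y = 32m.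
  Q5→C3x : count N Q5? ≡ count N C3x?
  Q5→C3x = count-bijection N Q5? C3x? f5 (λ {p} → mixed-in-box 191 79 N {proj₁ p} {proj₂ p})
    (λ {p} c → OddSol-in-box {p} (proj₁ (proj₁ (proj₁ (proj₁ (proj₁ c))))))
    (λ {p} → into {p}) (injective-by-scaled-inverse (+ 32) f5 (λ p → proj₁ p + + 5 * proj₂ p , + 3 * proj₁ p - proj₂ p - + 16) (λ m z → cong₂ _,_ (undo₁ m z) (undo₂ m z))) (λ {y} → onto {y})
    where
    form-identity : ∀ m Z → + 3 * ((+ 2 * m + + 5 * Z) * (+ 2 * m + + 5 * Z)) + + 5 * ((+ 6 * m - Z) * (+ 6 * m - Z)) ≡ + 192 * (m * m) + + 80 * (Z * Z)
    form-identity = solve-∀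
    undo₁ : ∀ m z → (+ 2 * m + + 5 * (+ 2 * z + + 1)) + + 5 * (+ 6 * m - (+ 2 * z + + 1)) ≡ + 32 * m
    undo₁ = solve-∀
    undo₂ : ∀ m z → + 3 * (+ 2 * m + + 5 * (+ 2 * z + + 1)) - (+ 6 * m - (+ 2 * z + + 1)) - + 16 ≡ + 32 * z
    undo₂ = solve-∀
    odd-X : ∀ m z → + 2 * (m + + 5 * z + + 2) + + 1 ≡ + 2 * m + + 5 * (+ 2 * z + + 1)
    odd-X = solve-∀
    odd-Y : ∀ m z → + 2 * (+ 3 * m - z - + 1) + + 1 ≡ + 6 * m - (+ 2 * z + + 1)
    odd-Y = solve-∀
    d1 : ∀ m z → (+ 2 * m + + 5 * (+ 2 * z + + 1)) - (+ 6 * m - (+ 2 * z + + 1)) ≡ + 2 * (+ 2 * (+ 3 * z - m + + 1) + + 1)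
    d1 = solve-∀
    d2 : ∀ m z → (+ 2 * m + + 5 * (+ 2 * z + + 1)) + (+ 6 * m - (+ 2 * z + + 1)) ≡ + 4 * (+ 2 * (m + z) + + 1)
    d2 = solve-∀
    d3 : ∀ m z → (+ 2 * m + + 5 * (+ 2 * z + + 1)) - + 3 * (+ 6 * m - (+ 2 * z + + 1)) ≡ ((+ 2 * z + + 1) - + 2 * m) * + 8
    d3 = solve-∀
    d4 : ∀ m z → (+ 2 * m + + 5 * (+ 2 * z + + 1)) + + 5 * (+ 6 * m - (+ 2 * z + + 1)) ≡ (+ 2 * m) * + 16
    d4 = solve-∀
    d5 : ∀ m z → (+ 2 * m + + 5 * (+ 2 * z + + 1)) + + 5 * (+ 6 * m - (+ 2 * z + + 1)) ≡ m * + 32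
    d5 = solve-∀
    into : ∀ {p} → Q5 p → C3x (f5 p)
    into {m , z} e = (((((subst Odd (odd-X m z) (Odd-odd (m + + 5 * z + + 2)) , subst Odd (odd-Y m z) (Odd-odd (+ 3 * m - z - + 1)) , trans (form-identity m (odd z)) e) ,
                      not-multiple-double-divides 2 2 (+ 3 * z - m + + 1) _ (d1 m z)) , not-double-divides 4 (m + z) _ (d2 m z)) , divides (odd z - + 2 * m) (d3 m z)) ,
                      divides (+ 2 * m) (d4 m z)) , divides m (d5 m z)
    onto : ∀ {y} → C3x y → ∃ λ x → Q5 x × f5 x ≡ y
    onto {X , Y} ((((((ox , oy , e) , _) , _) , _) , _) , divides q eq) with Odd⇒odd {Y} oy
    ... | b , refl = (q , + 3 * q - b - + 1) , trans (sym (form-identity q (odd (+ 3 * q - b - + 1)))) (trans (cong (λ p → form 3 5 (proj₁ p) (proj₂ p)) hits) e) , hits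
      where
      hits : f5 (q , + 3 * q - b - + 1) ≡ (X , odd b)
      hits = cong₂ _,_ (trans (coord₁ q b) (sym (solve-add X (+ 5 * odd b) (q * + 32) eq))) (coord₂ q b)
        where
        coord₁ : ∀ q b → + 2 * q + + 5 * (+ 2 * (+ 3 * q - b - + 1) + + 1) ≡ q * + 32 - + 5 * (+ 2 * b + + 1)
        coord₁ = solve-∀
        coord₂ : ∀ q b → + 6 * q - (+ 2 * (+ 3 * q - b - + 1) + + 1) ≡ + 2 * b + + 1
        coord₂ = solve-∀

  class-X≡Y : count N C1? ≡ count N Q1? ℕ.+ count N Q2?
  class-X≡Y = begin
      count N C1?                      ≡⟨ filter-length-split C1? B16? (box N) ⟩
      count N C1ab? ℕ.+ count N C1c?   ≡⟨ cong₂ ℕ._+_ Q1→C1ab Q2→C1c ⟨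
      count N Q1? ℕ.+ count N Q2?      ∎
    where open ≡-Reasoning

  class-X≡3Y : count N C3? ≡ count N Q5? ℕ.+ count N Q4? ℕ.+ count N Q3h?
  class-X≡3Y = begin
      count N C3?                                   ≡⟨ filter-length-split C3? F16? (box N) ⟩
      count N C3f? ℕ.+ count N C3c?                 ≡⟨ cong (ℕ._+ count N C3c?) (filter-length-split C3f? F32? (box N)) ⟩
      count N C3x? ℕ.+ count N C3y? ℕ.+ count N C3c? ≡⟨ cong₂ (λ s t → s ℕ.+ t ℕ.+ count N C3c?) Q5→C3x Q4→C3y ⟨
      count N Q5? ℕ.+ count N Q4? ℕ.+ count N C3c?   ≡⟨ cong (count N Q5? ℕ.+ count N Q4? ℕ.+_) Q3h→C3c ⟨
      count N Q5? ℕ.+ count N Q4? ℕ.+ count N Q3h?   ∎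
    where open ≡-Reasoning

  Q3-halves : count N Q3? ≡ 2 ℕ.* count N Q3h?
  Q3-halves = begin
      count N Q3?                     ≡⟨ sum-parity-split 12 20 N ⟩
      count N Q3h? ℕ.+ count N Q3o?   ≡⟨ cong (count N Q3h? ℕ.+_) (even-sum≡odd-sum 11 19 N) ⟨
      count N Q3h? ℕ.+ count N Q3h?   ≡⟨ cong (count N Q3h? ℕ.+_) (NP.+-identityʳ (count N Q3h?)) ⟨
      2 ℕ.* count N Q3h?              ∎
    where
    open ≡-Reasoning
    Q3o? : Decidable (OddSumRep 12 20 N)
    Q3o? = OddSumRep? 12 20 N

  first-reduction : count N (OddRep? 3 5 N) ≡
    2 ℕ.* count N (MixedRep? 480 8 N) ℕ.+ 2 ℕ.* count N (MixedRep? 32 120 N) ℕ.+ count N (OddRep? 12 20 N)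
      ℕ.+ 2 ℕ.* count N (MixedRep? 320 48 N) ℕ.+ 2 ℕ.* count N (MixedRep? 192 80 N)
  first-reduction = begin
      count N OddParam?                                       ≡⟨ split-count ⟩
      2 ℕ.* count N C1? ℕ.+ 2 ℕ.* count N C3?                 ≡⟨ cong₂ (λ s t → 2 ℕ.* s ℕ.+ 2 ℕ.* t) class-X≡Y class-X≡3Y ⟩
      2 ℕ.* (q₁ ℕ.+ q₂) ℕ.+ 2 ℕ.* (q₅ ℕ.+ q₄ ℕ.+ h)            ≡⟨ rearrange q₁ q₂ h q₄ q₅ ⟩
      2 ℕ.* q₁ ℕ.+ 2 ℕ.* q₂ ℕ.+ 2 ℕ.* h ℕ.+ 2 ℕ.* q₄ ℕ.+ 2 ℕ.* q₅ ≡⟨ cong (λ t → 2 ℕ.* q₁ ℕ.+ 2 ℕ.* q₂ ℕ.+ t ℕ.+ 2 ℕ.* q₄ ℕ.+ 2 ℕ.* q₅) Q3-halves ⟨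
      2 ℕ.* q₁ ℕ.+ 2 ℕ.* q₂ ℕ.+ count N Q3? ℕ.+ 2 ℕ.* q₄ ℕ.+ 2 ℕ.* q₅ ∎
    where
    open ≡-Reasoning
    q₁ q₂ h q₄ q₅ : ℕ
    q₁ = count N Q1?
    q₂ = count N Q2?
    h = count N Q3h?
    q₄ = count N Q4?
    q₅ = count N Q5?
    rearrange : ∀ a b c d e → 2 ℕ.* (a ℕ.+ b) ℕ.+ 2 ℕ.* (e ℕ.+ d ℕ.+ c) ≡ 2 ℕ.* a ℕ.+ 2 ℕ.* b ℕ.+ 2 ℕ.* c ℕ.+ 2 ℕ.* d ℕ.+ 2 ℕ.* e
    rearrange = NT.solve-∀

open import Defs
open import Data.Product using (_×_; _,_)
open LatticeCounts
open Representations
open ThetaTerms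
open import Data.Nat using (_+_; _*_; _<_; suc; z≤n; s≤s)
open import Data.Nat.Properties using (≤-<-trans; m≤n*m; m<m+n; *-cancelˡ-≡)
open import Data.Nat.Tactic.RingSolver using (solve-∀)
open import Relation.Binary.PropositionalEquality

n<8n+suc : ∀ n c → n < 8 * n + suc c
n<8n+suc n c = ≤-<-trans (m≤n*m n 8) (m<m+n (8 * n) (s≤s z≤n))

assemble : ∀ {L S c₁ c₂ c₃ c₄ c₅} W₁ W₂ W₃ W₄ W₅ →
  4 * L ≡ S → S ≡ 2 * c₁ + 2 * c₂ + c₃ + 2 * c₄ + 2 * c₅ →
  2 * W₁ ≡ c₁ → 2 * W₂ ≡ c₂ → 4 * W₃ ≡ c₃ → 2 * W₄ ≡ c₄ → 2 * W₅ ≡ c₅ →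
  L ≡ W₁ + W₂ + W₃ + W₄ + W₅
assemble {L} W₁ W₂ W₃ W₄ W₅ lhs reduction refl refl refl refl refl =
  *-cancelˡ-≡ L (W₁ + W₂ + W₃ + W₄ + W₅) 4 (trans lhs (trans reduction (regroup W₁ W₂ W₃ W₄ W₅)))
  where
  regroup : ∀ a b c d e → 2 * (2 * a) + 2 * (2 * b) + 4 * c + 2 * (2 * d) + 2 * (2 * e) ≡ 4 * (a + b + c + d + e)
  regroup = solve-∀

first-identity : ∀ n →
  (dil 3 ψ ⊛ dil 5 ψ) n ≡ (dil 60 φ ⊛ dil 8 ψ) n + shift 14 (dil 4 φ ⊛ dil 120 ψ) n
    + shift 3 (dil 12 ψ ⊛ dil 20 ψ) n + shift 5 (dil 40 φ ⊛ dil 48 ψ) n + shift 9 (dil 24 φ ⊛ dil 80 ψ) n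
first-identity n = assemble
  ((dil 60 φ ⊛ dil 8 ψ) n) (shift 14 (dil 4 φ ⊛ dil 120 ψ) n) (shift 3 (dil 12 ψ ⊛ dil 20 ψ) n)
  (shift 5 (dil 40 φ ⊛ dil 48 ψ) n) (shift 9 (dil 24 φ ⊛ dil 80 ψ) n)
  (ψψ-term 3 5 3 5 8 solve-∀)
  (FirstReduction.first-reduction N)
  (φψ-term 60 8 480 8 8 solve-∀)
  (φψ-shifted 14 4 120 32 120 8 solve-∀)
  (ψψ-shifted 3 12 20 12 20 8 solve-∀)
  (φψ-shifted 5 40 48 320 48 8 solve-∀)
  (φψ-shifted 9 24 80 192 80 8 solve-∀)
  where
  N : ℕ
  N = 8 * n + 8
  open Terms n N (n<8n+suc n 7)

second-identity : ∀ n →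
  (ψ ⊛ dil 15 ψ) n ≡ (dil 120 φ ⊛ dil 16 ψ) n + shift 28 (dil 8 φ ⊛ dil 240 ψ) n
    + shift 6 (dil 4 ψ ⊛ dil 60 ψ) n + shift 1 (dil 20 φ ⊛ dil 24 ψ) n + shift 3 (dil 12 φ ⊛ dil 40 ψ) n
second-identity n = assemble
  ((dil 120 φ ⊛ dil 16 ψ) n) (shift 28 (dil 8 φ ⊛ dil 240 ψ) n) (shift 6 (dil 4 ψ ⊛ dil 60 ψ) n)
  (shift 1 (dil 20 φ ⊛ dil 24 ψ) n) (shift 3 (dil 12 φ ⊛ dil 40 ψ) n)
  lhs
  (SecondReduction.second-reduction N)
  (φψ-term 120 16 960 16 16 solve-∀)
  (φψ-shifted 28 8 240 64 240 16 solve-∀)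
  (ψψ-shifted 6 4 60 4 60 16 solve-∀)
  (φψ-shifted 1 20 24 160 24 16 solve-∀)
  (φψ-shifted 3 12 40 96 40 16 solve-∀)
  where
  N : ℕ
  N = 8 * n + 16
  n<N : n < N
  n<N = n<8n+suc n 15
  open Terms n N n<N
  lhs : 4 * (ψ ⊛ dil 15 ψ) n ≡ count N (OddRep? 1 15 N)
  lhs = trans (product-count 2 2 ψ (dil 15 ψ) triangular (λ y → 15 * triangular y) N n (ψ-models N) (ψ-dil 15) n<N)
              (weight-to-form _ _ 16 n N (odd-weight 1 15 16 (λ s t → s + 15 * t) solve-∀))

lemma6p2 : (dil 3 ψ ⊛ dil 5 ψ
              ≐ dil 60 φ ⊛ dil 8 ψ
                ⊕ shift 14 (dil 4 φ ⊛ dil 120 ψ)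
                ⊕ shift 3 (dil 12 ψ ⊛ dil 20 ψ)
                ⊕ shift 5 (dil 40 φ ⊛ dil 48 ψ)
                ⊕ shift 9 (dil 24 φ ⊛ dil 80 ψ))
           × (ψ ⊛ dil 15 ψ
              ≐ dil 120 φ ⊛ dil 16 ψ
                ⊕ shift 28 (dil 8 φ ⊛ dil 240 ψ)
                ⊕ shift 6 (dil 4 ψ ⊛ dil 60 ψ)
                ⊕ shift 1 (dil 20 φ ⊛ dil 24 ψ)
                ⊕ shift 3 (dil 12 φ ⊛ dil 40 ψ))
lemma6p2 = first-identity , second-identity
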